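{- Let $G$ be a graph of order $n$ with minimum degree $\delta$ and clique number $\omega$. If $\delta+\omega\ge n+1$, then $G$ is hamiltonian-connected, unless $\frac{n+2}{2}\le \omega\le n-1$ and either $G\cong K_{n-\omega+1}\vee (K_{2\omega-n-1}\cup \overline{K_{n-\omega}})$ or $G\in\mathcal{H}(n,\omega)$.
   Context: All graphs are finite, undirected, without loops or multiple edges. The clique number of $G$ is the maximum cardinality of a clique in $G$. A graph is hamiltonian-connected if for any two distinct vertices there is a path between them containing all vertices of the graph. $K_m$ denotes the complete graph on $m$ vertices, $\overline{K_m}$ the edgeless graph on $m$ vertices, and $K_{1,m}$ the star with $m$ leaves. For graphs $G,H$, $G\cup H$ is their disjoint union and $G\vee H$ (the join) is obtained from $G\cup H$ by adding all edges between $V(G)$ and $V(H)$. For integers $n,\omega$ with $\frac{n+2}{2}\le\omega\le n-1$, let $H_1=K_2\vee(K_{\omega-2}\cup K_1)$ and $H_2=K_{1,n-\omega-1}$; let $x$ be the vertex of degree two in $H_1$ (the vertex of the $K_1$) and $y$ the center vertex of $H_2$ (the vertex of degree $n-\omega-1$). Let $H_1xyH_2$ be the graph obtained from $H_1\cup H_2$ by identifying $x$ and $y$ (a graph on $n$ vertices). Then $\mathcal{H}(n,\omega)$ is the set of graphs (up to isomorphism) that contain $H_1xyH_2$ as a spanning subgraph and are spanning subgraphs of $K_2\vee(K_{\omega-2}\cup K_{n-\omega})$. -}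

module Defs where

open import Data.Nat using (ℕ; zero; suc; _+_; _∸_; _≤_; _<_; _<ᵇ_)
open import Data.Bool using (Bool; true; false; T; not; _∧_; _∨_)
open import Data.Fin using (Fin; toℕ)
open import Data.Fin.Properties using () renaming (_≟_ to _≟ᶠ_)
open import Data.Fin.Subset using (Subset; _∈_; ∣_∣)
open import Data.List using (List; []; _∷_; _++_; length; filterᵇ; allFin)
open import Data.List.Relation.Unary.Linked using (Linked)
open import Data.List.Relation.Unary.Unique.Propositional using (Unique)
open import Data.List.Membership.Propositional using () renaming (_∈_ to _∈ˡ_)
open import Data.Product using (Σ; ∃; _×_)
open import Function.Bundles using (_↔_; Inverse)
open import Relation.Binary.PropositionalEquality using (_≡_; _≢_)
open import Relation.Nullary.Decidable using (⌊_⌋)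

record Graph (n : ℕ) : Set where
  field
    adj    : Fin n → Fin n → Bool
    sym    : ∀ u v → adj u v ≡ adj v u
    irrefl : ∀ v → adj v v ≡ false

open Graph public

Adj : ∀ {n} → Graph n → Fin n → Fin n → Set
Adj G u v = T (adj G u v)

degree : ∀ {n} → Graph n → Fin n → ℕ
degree {n} G v = length (filterᵇ (adj G v) (allFin n))

IsMinDegree : ∀ {n} → Graph n → ℕ → Set
IsMinDegree G δ = (∀ v → δ ≤ degree G v) × ∃ λ v → degree G v ≡ δ

IsClique : ∀ {n} → Graph n → Subset n → Set
IsClique G S = ∀ u v → u ∈ S → v ∈ S → u ≢ v → Adj G u v

IsCliqueNumber : ∀ {n} → Graph n → ℕ → Set
IsCliqueNumber G ω =
  (∃ λ S → IsClique G S × ∣ S ∣ ≡ ω) × (∀ S → IsClique G S → ∣ S ∣ ≤ ω)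

HamiltonianPath : ∀ {n} → Graph n → Fin n → Fin n → Set
HamiltonianPath {n} G u v =
  Σ (List (Fin n)) λ ms →
    let p = u ∷ (ms ++ v ∷ []) in
    Unique p × (∀ w → w ∈ˡ p) × Linked (Adj G) p

HamiltonianConnected : ∀ {n} → Graph n → Set
HamiltonianConnected G = ∀ u v → u ≢ v → HamiltonianPath G u v

_≅_ : ∀ {n} → Graph n → (Fin n → Fin n → Bool) → Set
_≅_ {n} G h = Σ (Fin n ↔ Fin n) λ f →
  ∀ u v → adj G u v ≡ h (Inverse.to f u) (Inverse.to f v)

_⊆ᵍ_ : ∀ {n} → (Fin n → Fin n → Bool) → (Fin n → Fin n → Bool) → Set
g ⊆ᵍ h = ∀ u v → T (g u v) → T (h u v)

neq : ∀ {n} → Fin n → Fin n → Bool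
neq u v = not ⌊ u ≟ᶠ v ⌋

below : ∀ {n} → ℕ → Fin n → Bool
below k u = toℕ u <ᵇ k

is : ∀ {n} → ℕ → Fin n → Bool
is k u = ⌊ toℕ u Data.Nat.≟ k ⌋

-- K_{n-ω+1} ∨ (K_{2ω-n-1} ∪ \overline{K_{n-ω}}):
--   A = {0 .. n-ω}          (the K_{n-ω+1}),
--   B = {n-ω+1 .. ω-1}      (the K_{2ω-n-1}),
--   C = {ω .. n-1}          (the independent set of size n-ω).
exceptional₁ : (n ω : ℕ) → Fin n → Fin n → Bool
exceptional₁ n ω u v =
  neq u v ∧ ((inA u ∨ inA v) ∨ (inB u ∧ inB v))
  where
  inA : Fin n → Bool
  inA = below (n ∸ ω + 1)
  inB : Fin n → Bool
  inB w = not (inA w) ∧ below ω w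

-- Labelling for H(n, ω):
--   0, 1            : the K_2,
--   2 .. ω-1        : the K_{ω-2},
--   ω               : the identified vertex x = y,
--   ω+1 .. n-1      : the leaves of the star K_{1,n-ω-1}.
-- Upper graph K_2 ∨ (K_{ω-2} ∪ K_{n-ω}) with K_{n-ω} = {ω .. n-1}.
upperH : (n ω : ℕ) → Fin n → Fin n → Bool
upperH n ω u v =
  neq u v ∧ ((inK2 u ∨ inK2 v) ∨ ((inB u ∧ inB v) ∨ (inC u ∧ inC v)))
  where
  inK2 : Fin n → Bool
  inK2 = below 2
  inB : Fin n → Bool
  inB w = not (inK2 w) ∧ below ω w
  inC : Fin n → Bool
  inC w = not (below ω w)

-- Lower graph H₁xyH₂ where H₁ = K_2 ∨ (K_{ω-2} ∪ K_1) and H₂ = K_{1,n-ω-1}.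
lowerH : (n ω : ℕ) → Fin n → Fin n → Bool
lowerH n ω u v =
  neq u v ∧ ((inK2 u ∨ inK2 v) ∧ below (suc ω) u ∧ below (suc ω) v
             ∨ ((inB u ∧ inB v) ∨ (is ω u ∨ is ω v) ∧ inC u ∧ inC v))
  where
  inK2 : Fin n → Bool
  inK2 = below 2
  inB : Fin n → Bool
  inB w = not (inK2 w) ∧ below ω w
  inC : Fin n → Bool
  inC w = not (below ω w)

InH : ∀ {n} → (ω : ℕ) → Graph n → Set
InH {n} ω G = Σ (Graph n) λ F →
  (lowerH n ω ⊆ᵍ adj F) × (adj F ⊆ᵍ upperH n ω) × (G ≅ adj F)

module Submission where

-- Let K be a clique of size ω and R the remaining r = n - ω < δ vertices.
-- Everything rests on the Bondy–Chvátal closure for spanning paths of a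
-- vertex set U: a missing edge uv with d_U(u) + d_U(v) > |U| can be
-- added without creating new spanning paths of U (Pósa rotation).  If
-- 2δ > n this is Ore's theorem.  Otherwise split K into K₁, the vertices
-- with a neighbour in R, and K₀, and let U be all vertices except those
-- of K₀ other than one vertex z.  All edges between K₁ and R are closure
-- edges; after adding them, depending on how ω₁ = |K₁| compares with r,
-- at most two more closure stages make U complete, unless ω₁ = r + 1 and
-- R is independent, or ω₁ = 2 ≤ r, which are exactly the two exceptional
-- families.  The vertices of K₀ only see K, so they are spliced into a
-- spanning path of U through the clique K.

open import Data.Bool using (Bool; true; false; T; not; _∧_; _∨_; if_then_else_)
open import Data.Bool.Properties using (T-∧; T-∨; T-≡; ∧-comm; ∨-comm; ∧-assoc; ∧-distribʳ-∨; ∧-identityʳ; ∧-zeroʳ)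
open import Data.Empty using (⊥; ⊥-elim)
open import Data.Fin using (Fin; zero; suc; toℕ; fromℕ<; punchOut)
open import Data.Fin.Properties using (_≟_; any?; toℕ<n; toℕ-fromℕ<; toℕ-injective; punchOut-injective; injective⇒≤)
open import Data.Fin.Subset using (Subset; _∈_; ∣_∣)
open import Data.List using (List; []; _∷_; _++_; length; filterᵇ; tabulate; allFin; initLast; _∷ʳ′_)
open import Data.List.Membership.Propositional using () renaming (_∈_ to _∈ˡ_)
open import Data.List.Properties using (length-++; ++-assoc)
open import Data.List.Relation.Unary.All as All using (All)
import Data.List.Relation.Unary.AllPairs as AllPairs
open import Data.List.Relation.Unary.Any using (here; there)
open import Data.List.Relation.Unary.Linked as Linked using (Linked)
open import Data.List.Relation.Unary.Unique.Propositional using (Unique)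
open import Data.Nat using (ℕ; zero; suc; _+_; _∸_; _*_; _≤_; _<_; _<ᵇ_; _≤ᵇ_; z≤n; s≤s; _≤?_)
open import Data.Nat.Properties
  using ( *-monoˡ-≤; +-assoc; +-cancelʳ-≤; +-cancelˡ-≡; +-cancelˡ-≤; +-comm; +-commutativeSemigroup
        ; +-identityʳ; +-mono-≤; +-monoʳ-<; +-monoʳ-≤; +-monoˡ-≤; +-suc; 1+n≢0; 1+n≰n; <-asym; <-cmp
        ; <-irrefl; <-trans; <-≤-trans; <ᵇ⇒<; <⇒<ᵇ; <⇒≱; m+n∸m≡n; m+n≡0⇒n≡0; m+n≤o⇒m≤o∸n; m≤m+n
        ; m≤n+m; n≤0⇒n≡0; n≤1+n; ≤-<-trans; ≤-antisym; ≤-pred; ≤-refl; ≤-reflexive; ≤-trans; ≤ᵇ⇒≤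
        ; ≤⇒≤ᵇ; ≤∧≢⇒<; ≮⇒≥; ≰⇒>; module ≤-Reasoning )
  renaming (_≟_ to _≟ⁿ_)
open import Data.Nat.Solver using (module +-*-Solver)
open import Algebra.Properties.CommutativeSemigroup +-commutativeSemigroup using ()
  renaming (interchange to +-interchange)
open import Data.Product using (Σ; ∃; _×_; _,_; proj₁; proj₂)
open import Data.Sum using (_⊎_; inj₁; inj₂; [_,_])
open import Data.Unit using (⊤; tt)
open import Data.Vec as Vec using (lookup)
open import Data.Vec.Properties using (lookup⇒[]=)
open import Function.Base using (_∘_)
open import Function.Bundles using (Equivalence; Inverse; _↔_; mk↔ₛ′)
open import Relation.Binary.Bundles using (Setoid)
open import Relation.Binary.Definitions using (tri<; tri≈; tri>)
open import Relation.Binary.PropositionalEquality using (_≡_; _≢_; refl; sym; trans; cong; cong₂; subst; subst₂; module ≡-Reasoning)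
import Relation.Binary.Reasoning.Setoid as SetoidReasoning
open import Relation.Nullary using (¬_; Dec; yes; no; does)
open import Relation.Nullary.Decidable using (T?)

open import Defs hiding (sym)

∧⁺ : ∀ {a b} → T a → T b → T (a ∧ b)
∧⁺ p q = Equivalence.from T-∧ (p , q)

∧⁻ˡ : ∀ {a b} → T (a ∧ b) → T a
∧⁻ˡ {a} {b} t = proj₁ (Equivalence.to (T-∧ {a} {b}) t)

∧⁻ʳ : ∀ {a b} → T (a ∧ b) → T b
∧⁻ʳ {a} {b} t = proj₂ (Equivalence.to (T-∧ {a} {b}) t)

∨⁺ˡ : ∀ {a b} → T a → T (a ∨ b)
∨⁺ˡ p = Equivalence.from T-∨ (inj₁ p)

∨⁺ʳ : ∀ {a b} → T b → T (a ∨ b)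
∨⁺ʳ {a} q = Equivalence.from (T-∨ {a}) (inj₂ q)

∨⁻ : ∀ {a b} → T (a ∨ b) → T a ⊎ T b
∨⁻ {a} {b} = Equivalence.to (T-∨ {a} {b})

not⁺ : ∀ {a} → ¬ T a → T (not a)
not⁺ {true}  ¬t = ¬t tt
not⁺ {false} _  = tt

not⁻ : ∀ {a} → T (not a) → ¬ T a
not⁻ {true}  ()
not⁻ {false} _ ()

T-injective : ∀ {a b} → (T a → T b) → (T b → T a) → a ≡ b
T-injective {true}  {true}  _ _ = refl
T-injective {true}  {false} f _ = ⊥-elim (f tt)
T-injective {false} {true}  _ g = ⊥-elim (g tt)
T-injective {false} {false} _ _ = refl

does⁻ : ∀ {P : Set} (d : Dec P) → T (does d) → P
does⁻ (yes p) _ = p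

does⁺ : ∀ {P : Set} (d : Dec P) → P → T (does d)
does⁺ (yes _) _ = tt
does⁺ (no ¬p) p = ¬p p

_≡ᵇ_ : ∀ {n} → Fin n → Fin n → Bool
u ≡ᵇ v = does (u ≟ v)

≡ᵇ⇒≡ : ∀ {n} {u v : Fin n} → T (u ≡ᵇ v) → u ≡ v
≡ᵇ⇒≡ {u = u} {v} = does⁻ (u ≟ v)

≡⇒≡ᵇ : ∀ {n} {u v : Fin n} → u ≡ v → T (u ≡ᵇ v)
≡⇒≡ᵇ {u = u} refl with u ≟ u
... | yes _   = tt
... | no u≢u  = u≢u refl

≡ᵇ-refl : ∀ {n} (u : Fin n) → T (u ≡ᵇ u)
≡ᵇ-refl u = ≡⇒≡ᵇ {u = u} refl

≡ᵇ-sym : ∀ {n} (u v : Fin n) → (u ≡ᵇ v) ≡ (v ≡ᵇ u)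
≡ᵇ-sym u v with u ≟ v | v ≟ u
... | yes _   | yes _   = refl
... | no  _   | no  _   = refl
... | yes u≡v | no  v≢u = ⊥-elim (v≢u (sym u≡v))
... | no  u≢v | yes v≡u = ⊥-elim (u≢v (sym v≡u))

≢⇒¬≡ᵇ : ∀ {n} {u v : Fin n} → u ≢ v → T (not (u ≡ᵇ v))
≢⇒¬≡ᵇ u≢v = not⁺ (λ t → u≢v (≡ᵇ⇒≡ t))

-- Counting

VertexSet : ℕ → Set
VertexSet n = Fin n → Bool

ind : Bool → ℕ
ind true  = 1
ind false = 0

count : ∀ {n} → VertexSet n → ℕ
count {zero}  p = 0
count {suc n} p = ind (p zero) + count (λ i → p (suc i))

countL : ∀ {A : Set} → (A → Bool) → List A → ℕ
countL p []       = 0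
countL p (x ∷ xs) = ind (p x) + countL p xs

ind≤1 : ∀ b → ind b ≤ 1
ind≤1 true  = s≤s z≤n
ind≤1 false = z≤n

ind-mono : ∀ {a b} → (T a → T b) → ind a ≤ ind b
ind-mono {true}  {true}  _ = ≤-refl
ind-mono {true}  {false} f = ⊥-elim (f tt)
ind-mono {false}         _ = z≤n

ind-< : ∀ {a b} → T b → ¬ T a → ind a < ind b
ind-< {true}         _ ¬a = ⊥-elim (¬a tt)
ind-< {false} {true} _ _  = ≤-refl

ind-exclusive : ∀ {a b} → (T a → T b → ⊥) → ind a + ind b ≤ 1
ind-exclusive {true}  {true}  f = ⊥-elim (f tt tt)
ind-exclusive {true}  {false} _ = ≤-refl
ind-exclusive {false} {b}     _ = ind≤1 b

ind-false : ∀ {a} → ¬ T a → ind a ≡ 0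
ind-false {true}  ¬t = ⊥-elim (¬t tt)
ind-false {false} _  = refl

ind-true : ∀ {a} → T a → ind a ≡ 1
ind-true {true} _ = refl

ind-∨ : ∀ a b → (T a → T b → ⊥) → ind (a ∨ b) ≡ ind a + ind b
ind-∨ true  true  f = ⊥-elim (f tt tt)
ind-∨ true  false _ = refl
ind-∨ false b     _ = refl

count-cong : ∀ {n} (p q : VertexSet n) → (∀ i → p i ≡ q i) → count p ≡ count q
count-cong {zero}  p q e = refl
count-cong {suc n} p q e = cong₂ _+_ (cong ind (e zero)) (count-cong _ _ (λ i → e (suc i)))

count-mono : ∀ {n} (p q : VertexSet n) → (∀ i → T (p i) → T (q i)) → count p ≤ count q
count-mono {zero}  p q f = z≤n
count-mono {suc n} p q f = +-mono-≤ (ind-mono (f zero)) (count-mono _ _ (λ i → f (suc i)))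

count-mono-< : ∀ {n} (p q : VertexSet n) → (∀ i → T (p i) → T (q i)) →
               ∀ w → T (q w) → ¬ T (p w) → count p < count q
count-mono-< {suc n} p q f zero qw ¬pw =
  +-mono-≤ (ind-< qw ¬pw) (count-mono _ _ (λ i → f (suc i)))
count-mono-< {suc n} p q f (suc w) qw ¬pw =
  ≤-trans (≤-reflexive (sym (+-suc (ind (p zero)) _)))
          (+-mono-≤ (ind-mono (f zero)) (count-mono-< _ _ (λ i → f (suc i)) w qw ¬pw))

count-⊆-≥ : ∀ {n} (p q : VertexSet n) → (∀ i → T (p i) → T (q i)) →
            count q ≤ count p → ∀ i → T (q i) → T (p i)
count-⊆-≥ p q f q≤p i qi with T? (p i)
... | yes pi = pi
... | no ¬pi = ⊥-elim (<-irrefl refl (<-≤-trans (count-mono-< p q f i qi ¬pi) q≤p))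

count-∨ : ∀ {n} (p q : VertexSet n) → (∀ i → T (p i) → T (q i) → ⊥) →
          count (λ i → p i ∨ q i) ≡ count p + count q
count-∨ {zero}  p q disj = refl
count-∨ {suc n} p q disj = begin
  ind (p zero ∨ q zero) + count (λ i → p (suc i) ∨ q (suc i))
    ≡⟨ cong₂ _+_ (ind-∨ (p zero) (q zero) (disj zero)) (count-∨ _ _ (λ i → disj (suc i))) ⟩
  (ind (p zero) + ind (q zero)) + (count (λ i → p (suc i)) + count (λ i → q (suc i)))
    ≡⟨ +-interchange (ind (p zero)) (ind (q zero)) _ _ ⟩
  count p + count q ∎
  where open ≡-Reasoning

count-split : ∀ {n} (p q : VertexSet n) → count p ≡ count (λ i → p i ∧ q i) + count (λ i → p i ∧ not (q i))
count-split p q = trans (count-cong _ _ (λ i → case-split (p i) (q i)))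
                        (count-∨ _ _ (λ i t t′ → not⁻ (∧⁻ʳ {p i} t′) (∧⁻ʳ {p i} t)))
  where
  case-split : ∀ a b → a ≡ (a ∧ b) ∨ (a ∧ not b)
  case-split true  true  = refl
  case-split true  false = refl
  case-split false _     = refl

count-∨-≤ : ∀ {n} (p q : VertexSet n) → count (λ i → p i ∨ q i) ≤ count p + count q
count-∨-≤ {zero}  p q = z≤n
count-∨-≤ {suc n} p q = ≤-trans (+-mono-≤ (ind-∨-≤ (p zero) (q zero)) (count-∨-≤ (p ∘ suc) (q ∘ suc)))
                                (≤-reflexive (+-interchange (ind (p zero)) (ind (q zero)) _ _))
  where
  ind-∨-≤ : ∀ a b → ind (a ∨ b) ≤ ind a + ind b
  ind-∨-≤ true  b = s≤s z≤n
  ind-∨-≤ false b = ≤-refl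

count-false : ∀ {n} → count {n} (λ _ → false) ≡ 0
count-false {zero}  = refl
count-false {suc n} = count-false {n}

count-true : ∀ {n} → count {n} (λ _ → true) ≡ n
count-true {zero}  = refl
count-true {suc n} = cong suc (count-true {n})

count-singleton : ∀ {n} (p : VertexSet n) a → count (λ i → p i ∧ (i ≡ᵇ a)) ≡ ind (p a)
count-singleton {suc n} p zero = begin
  ind (p zero ∧ true) + count (λ i → p (suc i) ∧ false)
    ≡⟨ cong₂ _+_ (cong ind (∧-identityʳ (p zero))) (count-cong _ _ (λ i → ∧-zeroʳ (p (suc i)))) ⟩
  ind (p zero) + count {n} (λ _ → false)
    ≡⟨ cong (ind (p zero) +_) (count-false {n}) ⟩
  ind (p zero) + 0
    ≡⟨ +-identityʳ _ ⟩
  ind (p zero) ∎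
  where open ≡-Reasoning
count-singleton {suc n} p (suc a) =
  cong₂ _+_ (cong ind (∧-zeroʳ (p zero))) (count-singleton {n} (λ i → p (suc i)) a)

count-≡ᵇ : ∀ {n} (t : Fin n) → count (_≡ᵇ t) ≡ 1
count-≡ᵇ t = count-singleton (λ _ → true) t

count-pick : ∀ {n} (p : VertexSet n) a → count p ≡ ind (p a) + count (λ i → p i ∧ not (i ≡ᵇ a))
count-pick p a = trans (count-split p (λ i → i ≡ᵇ a)) (cong (_+ count (λ i → p i ∧ not (i ≡ᵇ a))) (count-singleton p a))

count-remove : ∀ {n} (p : VertexSet n) a → T (p a) → count p ≡ suc (count (λ i → p i ∧ not (i ≡ᵇ a)))
count-remove p a pa = trans (count-pick p a) (cong (_+ count (λ i → p i ∧ not (i ≡ᵇ a))) (ind-true pa))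

count-witness : ∀ {n} (p : VertexSet n) w → T (p w) → 1 ≤ count p
count-witness p w pw = subst (_≤ count p) (count-singleton (λ _ → true) w)
  (count-mono _ p (λ i i≡w → subst (T ∘ p) (sym (≡ᵇ⇒≡ i≡w)) pw))

count-nonempty : ∀ {n} (p : VertexSet n) → 1 ≤ count p → ∃ λ i → T (p i)
count-nonempty {n} p 1≤ with any? (λ i → T? (p i))
... | yes found = found
... | no none = ⊥-elim (1+n≰n (≤-trans 1≤ (≤-trans (count-mono p _ (λ i pi → none (i , pi))) (≤-reflexive (count-false {n})))))

sumᶠ : ∀ {n} → (Fin n → ℕ) → ℕ
sumᶠ {zero}  f = 0
sumᶠ {suc n} f = f zero + sumᶠ (f ∘ suc)

sumᶠ-mono : ∀ {n} (f g : Fin n → ℕ) → (∀ i → f i ≤ g i) → sumᶠ f ≤ sumᶠ g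
sumᶠ-mono {zero}  f g f≤g = z≤n
sumᶠ-mono {suc n} f g f≤g = +-mono-≤ (f≤g zero) (sumᶠ-mono _ _ (f≤g ∘ suc))

sumᶠ-mono-< : ∀ {n} (f g : Fin n → ℕ) → (∀ i → f i ≤ g i) → ∀ j → f j < g j → sumᶠ f < sumᶠ g
sumᶠ-mono-< {suc n} f g f≤g zero    fj<gj = +-mono-≤ fj<gj (sumᶠ-mono _ _ (f≤g ∘ suc))
sumᶠ-mono-< {suc n} f g f≤g (suc j) fj<gj =
  ≤-trans (≤-reflexive (sym (+-suc (f zero) _))) (+-mono-≤ (f≤g zero) (sumᶠ-mono-< _ _ (f≤g ∘ suc) j fj<gj))

countL-++ : ∀ {A : Set} (p : A → Bool) xs ys → countL p (xs ++ ys) ≡ countL p xs + countL p ys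
countL-++ p []       ys = refl
countL-++ p (x ∷ xs) ys = trans (cong (ind (p x) +_) (countL-++ p xs ys)) (sym (+-assoc (ind (p x)) _ _))

countL-filter : ∀ {A : Set} (p q : A → Bool) xs → countL q (filterᵇ p xs) ≡ countL (λ x → p x ∧ q x) xs
countL-filter p q []       = refl
countL-filter p q (x ∷ xs) with p x
... | true  = cong (ind (q x) +_) (countL-filter p q xs)
... | false = countL-filter p q xs

countL-tabulate : ∀ {A : Set} {n} (p : A → Bool) (f : Fin n → A) → countL p (tabulate f) ≡ count (p ∘ f)
countL-tabulate {n = zero}  p f = refl
countL-tabulate {n = suc n} p f = cong (ind (p (f zero)) +_) (countL-tabulate p (f ∘ suc))

length≡countL : ∀ {A : Set} (xs : List A) → length xs ≡ countL (λ _ → true) xs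
length≡countL []       = refl
length≡countL (x ∷ xs) = cong suc (length≡countL xs)

degree≡count : ∀ {n} (G : Graph n) v → degree G v ≡ count (adj G v)
degree≡count {n} G v = begin
  length (filterᵇ (adj G v) (allFin n))             ≡⟨ length≡countL (filterᵇ (adj G v) (allFin n)) ⟩
  countL (λ _ → true) (filterᵇ (adj G v) (allFin n)) ≡⟨ countL-filter (adj G v) _ (allFin n) ⟩
  countL (λ w → adj G v w ∧ true) (allFin n)        ≡⟨ countL-tabulate (λ w → adj G v w ∧ true) (λ w → w) ⟩
  count (λ w → adj G v w ∧ true)                    ≡⟨ count-cong _ _ (λ w → ∧-identityʳ (adj G v w)) ⟩
  count (adj G v)                                   ∎
  where open ≡-Reasoning

∣∣≡count : ∀ {n} (S : Subset n) → ∣ S ∣ ≡ count (lookup S)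
∣∣≡count Vec.[]           = refl
∣∣≡count (true  Vec.∷ S) = cong suc (∣∣≡count S)
∣∣≡count (false Vec.∷ S) = ∣∣≡count S

-- Chains and walks

module _ {A : Set} where

  Chain : (A → A → Bool) → A → List A → Set
  Chain R c []      = ⊤
  Chain R c (d ∷ L) = T (R c d) × Chain R d L

  lastOf : A → List A → A
  lastOf c []      = c
  lastOf c (d ∷ L) = lastOf d L

  lastOf-++ : ∀ c L L₂ → lastOf c (L ++ L₂) ≡ lastOf (lastOf c L) L₂
  lastOf-++ c []      L₂ = refl
  lastOf-++ c (d ∷ L) L₂ = lastOf-++ d L L₂

  record Walk (R : A → A → Bool) (x y : A) : Set where
    constructor walk
    field
      steps : List A
      chain : Chain R x steps
      ends  : lastOf x steps ≡ y

    vertices : List A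
    vertices = x ∷ steps

  infix 4 _≋_

  record _≋_ (xs ys : List A) : Set where
    constructor mk≋
    field countL-≡ : ∀ p → countL p xs ≡ countL p ys

  open _≋_ public

  ≋-refl : ∀ {xs} → xs ≋ xs
  ≋-refl = mk≋ λ p → refl

  ≋-reflexive : ∀ {xs ys} → xs ≡ ys → xs ≋ ys
  ≋-reflexive refl = ≋-refl

  ≋-sym : ∀ {xs ys} → xs ≋ ys → ys ≋ xs
  ≋-sym e = mk≋ λ p → sym (countL-≡ e p)

  ≋-trans : ∀ {xs ys zs} → xs ≋ ys → ys ≋ zs → xs ≋ zs
  ≋-trans e e′ = mk≋ λ p → trans (countL-≡ e p) (countL-≡ e′ p)

  ≋-∷ : ∀ x {xs ys} → xs ≋ ys → x ∷ xs ≋ x ∷ ys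
  ≋-∷ x e = mk≋ λ p → cong (ind (p x) +_) (countL-≡ e p)

  ≋-++ : ∀ {xs xs′ ys ys′} → xs ≋ xs′ → ys ≋ ys′ → xs ++ ys ≋ xs′ ++ ys′
  ≋-++ {xs} {xs′} {ys} {ys′} e e′ = mk≋ λ p → begin
    countL p (xs ++ ys)          ≡⟨ countL-++ p xs ys ⟩
    countL p xs + countL p ys    ≡⟨ cong₂ _+_ (countL-≡ e p) (countL-≡ e′ p) ⟩
    countL p xs′ + countL p ys′  ≡⟨ countL-++ p xs′ ys′ ⟨
    countL p (xs′ ++ ys′)        ∎
    where open ≡-Reasoning

  ≋-++-comm : ∀ xs ys → xs ++ ys ≋ ys ++ xs
  ≋-++-comm xs ys = mk≋ λ p → trans (countL-++ p xs ys) (trans (+-comm (countL p xs) _) (sym (countL-++ p ys xs)))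

  ≋-setoid : Setoid _ _
  ≋-setoid = record
    { Carrier       = List A
    ; _≈_           = _≋_
    ; isEquivalence = record { refl = ≋-refl ; sym = ≋-sym ; trans = ≋-trans }
    }

  ≋-∷⁻ : ∀ x {xs ys} → x ∷ xs ≋ x ∷ ys → xs ≋ ys
  ≋-∷⁻ x e = mk≋ λ p → +-cancelˡ-≡ (ind (p x)) _ _ (countL-≡ e p)

  module _ {R : A → A → Bool} where

    chain-++⁺ : ∀ c L L₂ → Chain R c L → Chain R (lastOf c L) L₂ → Chain R c (L ++ L₂)
    chain-++⁺ c []      L₂ _        ch₂ = ch₂
    chain-++⁺ c (d ∷ L) L₂ (r , ch) ch₂ = r , chain-++⁺ d L L₂ ch ch₂

    chain-++⁻ : ∀ c L L₂ → Chain R c (L ++ L₂) → Chain R c L × Chain R (lastOf c L) L₂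
    chain-++⁻ c []      L₂ ch       = tt , ch
    chain-++⁻ c (d ∷ L) L₂ (r , ch) = let ch₁ , ch₂ = chain-++⁻ d L L₂ ch in (r , ch₁) , ch₂

    chain-mono : ∀ {S} → (∀ a b → T (R a b) → T (S a b)) → ∀ c L → Chain R c L → Chain S c L
    chain-mono f c []      _        = tt
    chain-mono f c (d ∷ L) (r , ch) = f c d r , chain-mono f d L ch

    chain-avoiding : ∀ {S} (P : A → Bool) → (∀ a b → T (S a b) → T (R a b) ⊎ (T (P a) ⊎ T (P b))) →
                     ∀ c L → countL P (c ∷ L) ≡ 0 → Chain S c L → Chain R c L
    chain-avoiding P f c []      _  _        = tt
    chain-avoiding P f c (d ∷ L) P∉ (s , ch) with f c d s
    ... | inj₁ r        = r , chain-avoiding P f d L (m+n≡0⇒n≡0 (ind (P c)) P∉) ch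
    ... | inj₂ (inj₁ pc) = ⊥-elim (1+n≢0 (trans (cong (_+ _) (sym (ind-true pc))) P∉))
    ... | inj₂ (inj₂ pd) = ⊥-elim (1+n≢0 (trans (cong (_+ _) (sym (ind-true pd))) (m+n≡0⇒n≡0 (ind (P c)) P∉)))

    append : ∀ {x y z} → Walk R x y → Walk R y z → Walk R x z
    append {x} (walk L ch end) (walk L′ ch′ end′) =
      walk (L ++ L′) (chain-++⁺ x L L′ ch (subst (λ v → Chain R v L′) (sym end) ch′))
           (trans (lastOf-++ x L L′) (trans (cong (λ v → lastOf v L′) end) end′))

    retarget : ∀ {x y y′} → y ≡ y′ → Walk R x y → Walk R x y′
    retarget y≡y′ (walk L ch end) = walk L ch (trans end y≡y′)

    data FirstStep (S : A → A → Bool) (c : A) : List A → Set where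
      all-in : ∀ {L} → Chain R c L → FirstStep S c L
      leaves : ∀ L₁ b L₂ → Chain R c L₁ → ¬ T (R (lastOf c L₁) b) → T (S (lastOf c L₁) b) →
               Chain S b L₂ → FirstStep S c (L₁ ++ b ∷ L₂)

    firstStep : ∀ {S} c L → Chain S c L → FirstStep S c L
    firstStep c []      _        = all-in tt
    firstStep c (d ∷ L) (s , ch) with T? (R c d)
    ... | no ¬r = leaves [] d L tt ¬r s ch
    ... | yes r with firstStep d L ch
    ...   | all-in ch′                = all-in (r , ch′)
    ...   | leaves L₁ b L₂ ch₁ ¬r′ s′ ch₂ = leaves (d ∷ L₁) b L₂ (r , ch₁) ¬r′ s′ ch₂

module Rotation {A : Set} (R : A → A → Bool) (R-sym : ∀ {a b} → T (R a b) → T (R b a)) where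

  open Walk

  reverse : ∀ c L → Chain R c L → Σ (Walk R (lastOf c L) c) λ w → vertices w ≋ c ∷ L
  reverse c []      _        = walk [] tt refl , ≋-refl
  reverse c (d ∷ L) (r , ch) with reverse d L ch
  ... | walk L′ ch′ end , same =
    walk (L′ ++ c ∷ []) (chain-++⁺ _ L′ (c ∷ []) ch′ (subst (λ e → T (R e c)) (sym end) (R-sym r) , tt))
         (lastOf-++ _ L′ (c ∷ [])) ,
    ≋-trans (≋-++ same ≋-refl) (≋-++-comm (d ∷ L) (c ∷ []))

  reverseWalk : ∀ {x y} (w : Walk R x y) → Σ (Walk R y x) λ w′ → vertices w′ ≋ vertices w
  reverseWalk {x} (walk L ch refl) = reverse x L ch

  initCount : (A → Bool) → A → List A → ℕ
  initCount P c []      = 0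
  initCount P c (d ∷ L) = ind (P c) + initCount P d L

  countL-initCount : ∀ P c L → countL P (c ∷ L) ≡ initCount P c L + ind (P (lastOf c L))
  countL-initCount P c []      = +-comm (ind (P c)) 0
  countL-initCount P c (d ∷ L) = trans (cong (ind (P c) +_) (countL-initCount P d L)) (sym (+-assoc (ind (P c)) _ _))

  data Crossing (P Q : A → Bool) (c : A) : List A → Set where
    crossing    : ∀ M q N → T (P (lastOf c M)) → T (Q q) → Crossing P Q c (M ++ q ∷ N)
    no-crossing : ∀ {L} → initCount P c L + countL Q L ≤ length L → Crossing P Q c L

  crossing-step : ∀ P Q c d L → (T (P c) → T (Q d) → ⊥) → initCount P d L + countL Q L ≤ length L →
                  initCount P c (d ∷ L) + countL Q (d ∷ L) ≤ length (d ∷ L)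
  crossing-step P Q c d L not-both bound = begin
    (ind (P c) + initCount P d L) + (ind (Q d) + countL Q L)  ≡⟨ +-interchange (ind (P c)) _ _ _ ⟩
    (ind (P c) + ind (Q d)) + (initCount P d L + countL Q L)  ≤⟨ +-mono-≤ (ind-exclusive not-both) bound ⟩
    suc (length L)                                            ∎
    where open ≤-Reasoning

  crossing? : ∀ P Q c L → Crossing P Q c L
  crossing? P Q c []      = no-crossing z≤n
  crossing? P Q c (d ∷ L) with T? (P c) | T? (Q d) | crossing? P Q d L
  ... | yes pc | yes qd | _                    = crossing [] d L pc qd
  ... | _      | _      | crossing M q N pM qq = crossing (d ∷ M) q N pM qq
  ... | no ¬pc | _      | no-crossing bound    = no-crossing (crossing-step P Q c d L (λ pc _ → ¬pc pc) bound)
  ... | yes _  | no ¬qd | no-crossing bound    = no-crossing (crossing-step P Q c d L (λ _ qd → ¬qd qd) bound)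

  module _ (R-irrefl : ∀ a → ¬ T (R a a)) (x : A) (L₁ : List A) (b : A) (L₂ : List A) where

    private
      a = lastOf x L₁
      P = x ∷ L₁ ++ b ∷ L₂

    crossing-free-bound : initCount (R a) x L₁ + countL (R b) L₁ ≤ length L₁ →
                          initCount (R a) b L₂ + countL (R b) L₂ ≤ length L₂ →
                          countL (R a) P + countL (R b) P ≤ length P
    crossing-free-bound bound₁ bound₂ = begin
      countL (R a) P + countL (R b) P
        ≡⟨ cong₂ _+_ (trans (countL-++ (R a) (x ∷ L₁) (b ∷ L₂))
                            (cong₂ _+_ (countL-initCount (R a) x L₁) (countL-initCount (R a) b L₂)))
                     (countL-++ (R b) (x ∷ L₁) (b ∷ L₂)) ⟩
      ((iA + ind (R a a)) + (iB + ind (R a (lastOf b L₂)))) + ((ind (R b x) + cA) + (ind (R b b) + cB))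
        ≤⟨ +-mono-≤ (+-mono-≤ (≤-reflexive (cong (iA +_) (ind-false (R-irrefl a)))) (+-monoʳ-≤ iB (ind≤1 _)))
                    (+-mono-≤ (+-monoˡ-≤ cA (ind≤1 (R b x))) (≤-reflexive (cong (_+ cB) (ind-false (R-irrefl b))))) ⟩
      ((iA + 0) + (iB + 1)) + ((1 + cA) + (0 + cB))
        ≡⟨ solve 4 (λ iA iB cA cB → ((iA :+ con 0) :+ (iB :+ con 1)) :+ ((con 1 :+ cA) :+ (con 0 :+ cB))
                                   := con 2 :+ ((iA :+ cA) :+ (iB :+ cB))) refl iA iB cA cB ⟩
      2 + ((iA + cA) + (iB + cB))
        ≤⟨ +-monoʳ-≤ 2 (+-mono-≤ bound₁ bound₂) ⟩
      2 + (length L₁ + length L₂)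
        ≡⟨ cong suc (trans (sym (+-suc (length L₁) (length L₂))) (sym (length-++ L₁))) ⟩
      length P ∎
      where
      open ≤-Reasoning
      open +-*-Solver using (solve; _:+_; _:=_; con)
      iA iB cA cB : ℕ
      iA = initCount (R a) x L₁
      iB = initCount (R a) b L₂
      cA = countL (R b) L₁
      cB = countL (R b) L₂

  rotate-first : ∀ x M q N b L₂ → Chain R x (M ++ q ∷ N) → Chain R b L₂ →
                 T (R (lastOf x (M ++ q ∷ N)) (lastOf x M)) → T (R b q) →
                 Σ (Walk R x (lastOf b L₂)) λ w → vertices w ≋ x ∷ (M ++ q ∷ N) ++ b ∷ L₂
  rotate-first x M q N b L₂ ch₁ ch₂ ap bq with chain-++⁻ x M (q ∷ N) ch₁
  ... | chM , (_ , chN) with reverse q N chN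
  ...   | walk N′ chN′ endN′ , sameN =
    walk (M ++ lastOf q N ∷ N′ ++ b ∷ L₂)
         (chain-++⁺ x M _ chM
           (R-sym (subst (λ e → T (R e (lastOf x M))) (lastOf-++ x M (q ∷ N)) ap) ,
            chain-++⁺ _ N′ (b ∷ L₂) chN′ (subst (λ e → T (R e b)) (sym endN′) (R-sym bq) , ch₂)))
         (trans (lastOf-++ x M _) (lastOf-++ (lastOf q N) N′ (b ∷ L₂))) ,
    ≋-∷ x (≋-trans (≋-++ (≋-refl {xs = M}) (≋-++ sameN ≋-refl)) (≋-reflexive (sym (++-assoc M (q ∷ N) (b ∷ L₂)))))

  rotate-second : ∀ x L₁ b M q N → Chain R x L₁ → Chain R b (M ++ q ∷ N) →
                  T (R (lastOf x L₁) (lastOf b M)) → T (R b q) →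
                  Σ (Walk R x (lastOf b (M ++ q ∷ N))) λ w → vertices w ≋ x ∷ L₁ ++ b ∷ M ++ q ∷ N
  rotate-second x L₁ b M q N ch₁ ch₂ ap bq with chain-++⁻ b M (q ∷ N) ch₂
  ... | chM , (_ , chN) with reverse b M chM
  ...   | walk M′ chM′ endM′ , sameM =
    walk (L₁ ++ lastOf b M ∷ M′ ++ q ∷ N)
         (chain-++⁺ x L₁ _ ch₁ (ap , chain-++⁺ _ M′ (q ∷ N) chM′ (subst (λ e → T (R e q)) (sym endM′) bq , chN)))
         (trans (lastOf-++ x L₁ _) (trans (lastOf-++ (lastOf b M) M′ (q ∷ N)) (sym (lastOf-++ b M (q ∷ N))))) ,
    ≋-∷ x (≋-++ (≋-refl {xs = L₁}) (≋-++ sameM (≋-refl {xs = q ∷ N})))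

  -- Pósa rotation: if the ends a = lastOf x L₁ and b of the missing step
  -- together have more neighbours on the walk than it has vertices, some
  -- neighbour of a is followed by a neighbour of b, and reversing the
  -- segment between them closes the gap.
  rotate : (∀ a → ¬ T (R a a)) → ∀ x L₁ b L₂ → Chain R x L₁ → Chain R b L₂ →
           length (x ∷ L₁ ++ b ∷ L₂) < countL (R (lastOf x L₁)) (x ∷ L₁ ++ b ∷ L₂) + countL (R b) (x ∷ L₁ ++ b ∷ L₂) →
           Σ (Walk R x (lastOf b L₂)) λ w → vertices w ≋ x ∷ L₁ ++ b ∷ L₂
  rotate irr x L₁ b L₂ ch₁ ch₂ many
    with crossing? (R (lastOf x L₁)) (R b) x L₁ | crossing? (R (lastOf x L₁)) (R b) b L₂
  ... | crossing M q N ap bq | _                    = rotate-first x M q N b L₂ ch₁ ch₂ ap bq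
  ... | no-crossing _        | crossing M q N ap bq = rotate-second x L₁ b M q N ch₁ ch₂ ap bq
  ... | no-crossing bound₁   | no-crossing bound₂   =
    ⊥-elim (<⇒≱ many (crossing-free-bound irr x L₁ b L₂ bound₁ bound₂))

-- Spanning paths of a vertex set and their closure

occurs-head : ∀ {n} (c : Fin n) L → 1 ≤ countL (_≡ᵇ c) (c ∷ L)
occurs-head c L = ≤-trans (≤-reflexive (sym (ind-true (≡⇒≡ᵇ {u = c} refl)))) (m≤m+n _ _)

occurs-lastOf : ∀ {n} (c : Fin n) L → 1 ≤ countL (_≡ᵇ lastOf c L) (c ∷ L)
occurs-lastOf c []      = occurs-head c []
occurs-lastOf c (d ∷ L) = ≤-trans (occurs-lastOf d L) (m≤n+m _ (ind (c ≡ᵇ lastOf d L)))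

module _ {n : ℕ} where

  Adj-sym : (G : Graph n) → ∀ {u v} → Adj G u v → Adj G v u
  Adj-sym G {u} {v} = subst T (Graph.sym G u v)

  Adj-irrefl : (G : Graph n) → ∀ v → ¬ Adj G v v
  Adj-irrefl G v = subst T (Graph.irrefl G v)

  Adj⇒≢ : (G : Graph n) → ∀ {u v} → Adj G u v → u ≢ v
  Adj⇒≢ G {u} uv refl = Adj-irrefl G u uv

  elements : VertexSet n → List (Fin n)
  elements U = filterᵇ U (allFin n)

  countL-elements : ∀ U p → countL p (elements U) ≡ count (λ w → U w ∧ p w)
  countL-elements U p = trans (countL-filter U p (allFin n)) (countL-tabulate (λ w → U w ∧ p w) (λ w → w))

  elements-cong : ∀ {U V} → (∀ w → U w ≡ V w) → elements U ≋ elements V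
  elements-cong {U} {V} U≗V = mk≋ λ p → trans (countL-elements U p)
    (trans (count-cong _ _ (λ w → cong (_∧ p w) (U≗V w))) (sym (countL-elements V p)))

  elements-∨ : ∀ U V → (∀ w → T (U w) → T (V w) → ⊥) → elements (λ w → U w ∨ V w) ≋ elements U ++ elements V
  elements-∨ U V disjoint = mk≋ λ p → begin
    countL p (elements (λ w → U w ∨ V w))        ≡⟨ countL-elements _ p ⟩
    count (λ w → (U w ∨ V w) ∧ p w)              ≡⟨ count-cong _ _ (λ w → ∧-distribʳ-∨ (p w) (U w) (V w)) ⟩
    count (λ w → (U w ∧ p w) ∨ (V w ∧ p w))      ≡⟨ count-∨ _ _ (λ w uw vw → disjoint w (∧⁻ˡ uw) (∧⁻ˡ vw)) ⟩
    count (λ w → U w ∧ p w) + count (λ w → V w ∧ p w)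
      ≡⟨ cong₂ _+_ (countL-elements U p) (countL-elements V p) ⟨
    countL p (elements U) + countL p (elements V) ≡⟨ countL-++ p (elements U) (elements V) ⟨
    countL p (elements U ++ elements V)          ∎
    where open ≡-Reasoning

  _∖_ : VertexSet n → Fin n → VertexSet n
  (U ∖ x) w = U w ∧ not (w ≡ᵇ x)

  elements-pick : ∀ U {x} → T (U x) → elements U ≋ x ∷ elements (U ∖ x)
  elements-pick U {x} x∈U = mk≋ λ p → begin
    countL p (elements U)                           ≡⟨ countL-elements U p ⟩
    count (λ w → U w ∧ p w)                         ≡⟨ count-pick _ x ⟩
    ind (U x ∧ p x) + count (λ w → (U w ∧ p w) ∧ not (w ≡ᵇ x))
      ≡⟨ cong₂ _+_ (cong (λ b → ind (b ∧ p x)) (Equivalence.to T-≡ x∈U))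
                   (count-cong _ _ (λ w → swap (U w) (p w) (not (w ≡ᵇ x)))) ⟩
    ind (p x) + count (λ w → (U ∖ x) w ∧ p w)      ≡⟨ cong (ind (p x) +_) (countL-elements (U ∖ x) p) ⟨
    countL p (x ∷ elements (U ∖ x))                 ∎
    where
    open ≡-Reasoning
    swap : ∀ a b c → (a ∧ b) ∧ c ≡ (a ∧ c) ∧ b
    swap a b c = trans (∧-assoc a b c) (trans (cong (a ∧_) (∧-comm b c)) (sym (∧-assoc a c b)))

  degreeIn : Graph n → VertexSet n → Fin n → ℕ
  degreeIn G U v = count (λ w → U w ∧ adj G v w)

  record SpanningPath (G : Graph n) (U : VertexSet n) (x y : Fin n) : Set where
    constructor spanning
    field
      route      : Walk (adj G) x y
      enumerates : Walk.vertices route ≋ elements U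

  HamiltonianConnectedIn : Graph n → VertexSet n → Set
  HamiltonianConnectedIn G U = ∀ x y → T (U x) → T (U y) → x ≢ y → SpanningPath G U x y

  module _ {U : VertexSet n} {P : List (Fin n)} (enum : P ≋ elements U) where

    countL-enumeration : ∀ p → countL p P ≡ count (λ w → U w ∧ p w)
    countL-enumeration p = trans (countL-≡ enum p) (countL-elements U p)

    occurrences : ∀ w → countL (_≡ᵇ w) P ≡ ind (U w)
    occurrences w = trans (countL-enumeration (_≡ᵇ w)) (count-singleton U w)

    occurs⇒∈ : ∀ {w} → 1 ≤ countL (_≡ᵇ w) P → T (U w)
    occurs⇒∈ {w} occ with U w | occurrences w
    ... | true  | _  = tt
    ... | false | eq = ⊥-elim (1+n≰n (subst (1 ≤_) eq occ))

    enumeration-tail : ∀ {x xs} → P ≡ x ∷ xs → xs ≋ elements (U ∖ x)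
    enumeration-tail {x} {xs} refl = mk≋ λ p → +-cancelˡ-≡ (ind (p x)) _ _
      (countL-≡ (≋-trans enum (elements-pick U (occurs⇒∈ (occurs-head x xs)))) p)

    length-enumeration : length P ≡ count U
    length-enumeration = trans (length≡countL P)
      (trans (countL-enumeration (λ _ → true)) (count-cong _ _ (λ w → ∧-identityʳ (U w))))

  module _ {U : VertexSet n} {x L₁ b L₂} (enum : x ∷ L₁ ++ b ∷ L₂ ≋ elements U) where

    private
      occurrences-split : ∀ w → countL (_≡ᵇ w) (x ∷ L₁) + countL (_≡ᵇ w) (b ∷ L₂) ≡ ind (U w)
      occurrences-split w = trans (sym (countL-++ (_≡ᵇ w) (x ∷ L₁) (b ∷ L₂))) (occurrences enum w)

    lastOf-∈ : T (U (lastOf x L₁))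
    lastOf-∈ = occurs⇒∈ enum (≤-trans (occurs-lastOf x L₁) (≤-trans (m≤m+n _ _)
                 (≤-reflexive (sym (countL-++ (_≡ᵇ lastOf x L₁) (x ∷ L₁) (b ∷ L₂))))))

    middle-∈ : T (U b)
    middle-∈ = occurs⇒∈ enum (≤-trans (occurs-head b L₂) (≤-trans (m≤n+m _ (countL (_≡ᵇ b) (x ∷ L₁)))
                 (≤-reflexive (sym (countL-++ (_≡ᵇ b) (x ∷ L₁) (b ∷ L₂))))))

    lastOf-∉ : countL (_≡ᵇ lastOf x L₁) (b ∷ L₂) ≡ 0
    lastOf-∉ = n≤0⇒n≡0 (+-cancelˡ-≤ 1 _ 0 (≤-trans (+-monoˡ-≤ _ (occurs-lastOf x L₁))
                 (≤-trans (≤-reflexive (occurrences-split (lastOf x L₁))) (ind≤1 (U (lastOf x L₁))))))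

  IsEdge : Fin n → Fin n → Fin n → Fin n → Set
  IsEdge u v a b = (a ≡ u × b ≡ v) ⊎ (a ≡ v × b ≡ u)

  edge-touches : ∀ {u v a b w} → IsEdge u v a b → w ≡ u ⊎ w ≡ v → T (a ≡ᵇ w) ⊎ T (b ≡ᵇ w)
  edge-touches {a = a} {b} (inj₁ (refl , refl)) (inj₁ refl) = inj₁ (≡ᵇ-refl a)
  edge-touches {a = a} {b} (inj₁ (refl , refl)) (inj₂ refl) = inj₂ (≡ᵇ-refl b)
  edge-touches {a = a} {b} (inj₂ (refl , refl)) (inj₁ refl) = inj₂ (≡ᵇ-refl b)
  edge-touches {a = a} {b} (inj₂ (refl , refl)) (inj₂ refl) = inj₁ (≡ᵇ-refl a)

  edge-bound : ∀ {u v a b m} (P : Fin n → Set) (d : Fin n → ℕ) → IsEdge u v a b →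
               (P u → P v → m < d u + d v) → P a → P b → m < d a + d b
  edge-bound P d (inj₁ (refl , refl)) bound pa pb = bound pa pb
  edge-bound {u} {v} {m = m} P d (inj₂ (refl , refl)) bound pa pb = subst (m <_) (+-comm (d u) (d v)) (bound pb pa)

  -- The Bondy–Chvátal closure step: the first step of the path that is
  -- not in G is uv, and a rotation removes it.
  closure-step : (G H : Graph n) (U : VertexSet n) (u v : Fin n) →
    (∀ a b → Adj H a b → Adj G a b ⊎ IsEdge u v a b) →
    (T (U u) → T (U v) → count U < degreeIn G U u + degreeIn G U v) →
    ∀ {x y} → SpanningPath H U x y → SpanningPath G U x y
  closure-step G H U u v H⊆G+uv heavy {x} (spanning (walk L ch end) enum)
    with firstStep {R = adj G} x L ch
  ... | all-in ch′ = spanning (walk L ch′ end) enum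
  ... | leaves L₁ b L₂ ch₁ ¬ab ab ch₂ =
    let w , same = Rotation.rotate (adj G) (Adj-sym G) (Adj-irrefl G) x L₁ b L₂ ch₁ ch₂′ heavy′ in
    spanning (retarget (trans (sym (lastOf-++ x L₁ (b ∷ L₂))) end) w) (≋-trans same enum)
    where
    a : Fin n
    a = lastOf x L₁
    P : List (Fin n)
    P = x ∷ L₁ ++ b ∷ L₂

    edge : IsEdge u v a b
    edge with H⊆G+uv a b ab
    ... | inj₁ g = ⊥-elim (¬ab g)
    ... | inj₂ e = e

    ch₂′ : Chain (adj G) b L₂
    ch₂′ = chain-avoiding (_≡ᵇ a) G-step b L₂ (lastOf-∉ enum) ch₂
      where
      G-step : ∀ c d → Adj H c d → Adj G c d ⊎ (T (c ≡ᵇ a) ⊎ T (d ≡ᵇ a))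
      G-step c d cd with H⊆G+uv c d cd
      ... | inj₁ g = inj₁ g
      ... | inj₂ e = inj₂ (edge-touches e ([ (λ (a≡u , _) → inj₁ a≡u) , (λ (a≡v , _) → inj₂ a≡v) ] edge))

    heavy′ : length P < countL (adj G a) P + countL (adj G b) P
    heavy′ = subst₂ _<_ (sym (length-enumeration enum))
      (sym (cong₂ _+_ (countL-enumeration enum (adj G a)) (countL-enumeration enum (adj G b))))
      (edge-bound (T ∘ U) (degreeIn G U) edge heavy (lastOf-∈ enum) (middle-∈ enum))

  spanning-mono : ∀ {G H : Graph n} {U x y} → adj G ⊆ᵍ adj H → SpanningPath G U x y → SpanningPath H U x y
  spanning-mono G⊆H (spanning (walk L ch end) enum) = spanning (walk L (chain-mono G⊆H _ L ch) end) enum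

  spanning-reverse : ∀ (G : Graph n) {U x y} → SpanningPath G U x y → SpanningPath G U y x
  spanning-reverse G (spanning w enum) =
    let w′ , same = Rotation.reverseWalk (adj G) (Adj-sym G) w in spanning w′ (≋-trans same enum)

  spanning-cong : ∀ {G : Graph n} {U V x y} → (∀ w → U w ≡ V w) → SpanningPath G U x y → SpanningPath G V x y
  spanning-cong U≗V (spanning w enum) = spanning w (≋-trans enum (elements-cong U≗V))

  complete : Graph n
  complete = record
    { adj    = λ u v → not (u ≡ᵇ v)
    ; sym    = λ u v → cong not (≡ᵇ-sym u v)
    ; irrefl = λ v → cong not (Equivalence.to T-≡ (≡ᵇ-refl v))
    }

  addEdges : Graph n → (Fin n → Fin n → Bool) → Graph n
  addEdges G E = record
    { adj    = λ u v → not (u ≡ᵇ v) ∧ (adj G u v ∨ (E u v ∨ E v u))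
    ; sym    = λ u v → cong₂ _∧_ (cong not (≡ᵇ-sym u v)) (cong₂ _∨_ (Graph.sym G u v) (∨-comm (E u v) (E v u)))
    ; irrefl = λ v → cong (λ b → not b ∧ _) (Equivalence.to T-≡ (≡ᵇ-refl v))
    }

  addEdges-⊇ : ∀ (H : Graph n) E → adj H ⊆ᵍ adj (addEdges H E)
  addEdges-⊇ H E a b ab = ∧⁺ (≢⇒¬≡ᵇ (Adj⇒≢ H ab)) (∨⁺ˡ ab)

  edgeᵇ : Fin n → Fin n → Fin n → Fin n → Bool
  edgeᵇ u v a b = (a ≡ᵇ u ∧ b ≡ᵇ v) ∨ (a ≡ᵇ v ∧ b ≡ᵇ u)

  removeEdge : Graph n → Fin n → Fin n → Graph n
  removeEdge H u v = record
    { adj    = λ a b → adj H a b ∧ not (edgeᵇ u v a b)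
    ; sym    = λ a b → cong₂ _∧_ (Graph.sym H a b) (cong not (edgeᵇ-sym a b))
    ; irrefl = λ a → cong (_∧ _) (Graph.irrefl H a)
    }
    where
    edgeᵇ-sym : ∀ a b → edgeᵇ u v a b ≡ edgeᵇ u v b a
    edgeᵇ-sym a b = trans (cong₂ _∨_ (∧-comm (a ≡ᵇ u) (b ≡ᵇ v)) (∧-comm (a ≡ᵇ v) (b ≡ᵇ u)))
                          (∨-comm (b ≡ᵇ v ∧ a ≡ᵇ u) (b ≡ᵇ u ∧ a ≡ᵇ v))

  IsCliqueᵇ : Graph n → VertexSet n → Set
  IsCliqueᵇ G Q = ∀ a b → T (Q a) → T (Q b) → a ≢ b → Adj G a b

  chain-in-clique : ∀ {G Q} → IsCliqueᵇ G Q → ∀ {S} → (∀ w → T (S w) → T (Q w)) →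
                    ∀ c L → c ∷ L ≋ elements S → Chain (adj G) c L
  chain-in-clique cl S⊆Q c []      enum = tt
  chain-in-clique {G} {Q} cl {S} S⊆Q c (d ∷ L) enum =
    cl c d (S⊆Q c c∈S) (S⊆Q d d∈S) c≢d ,
    chain-in-clique {G} {Q} cl {S ∖ c} (λ w w∈S∖c → S⊆Q w (∧⁻ˡ w∈S∖c)) d L (enumeration-tail enum refl)
    where
    c∈S : T (S c)
    c∈S = occurs⇒∈ enum (occurs-head c (d ∷ L))
    d∈S : T (S d)
    d∈S = occurs⇒∈ enum (≤-trans (occurs-head d L) (m≤n+m _ (ind (c ≡ᵇ d))))
    c≢d : c ≢ d
    c≢d refl = 1+n≰n (≤-trans twice (≤-trans (≤-reflexive (occurrences enum c)) (ind≤1 (S c))))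
      where
      twice : 2 ≤ countL (_≡ᵇ c) (c ∷ c ∷ L)
      twice = subst (λ k → 2 ≤ k + (k + countL (_≡ᵇ c) L)) (sym (ind-true (≡ᵇ-refl c))) (s≤s (s≤s z≤n))

  clique-spanning : ∀ {G Q} → IsCliqueᵇ G Q → ∀ S → (∀ w → T (S w) → T (Q w)) → HamiltonianConnectedIn G S
  clique-spanning {G} {Q} cl S S⊆Q x y x∈S y∈S x≢y =
    spanning (walk (M ++ y ∷ []) (chain-in-clique {G} {Q} cl {S} S⊆Q x (M ++ y ∷ []) enum) (lastOf-++ x M (y ∷ []))) enum
    where
    M : List (Fin n)
    M = elements ((S ∖ x) ∖ y)
    enum : x ∷ M ++ y ∷ [] ≋ elements S
    enum = ≋-sym (≋-trans (elements-pick S x∈S) (≋-∷ x (≋-trans (elements-pick (S ∖ x) y∈S∖x) (≋-++-comm (y ∷ []) M))))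
      where
      y∈S∖x : T ((S ∖ x) y)
      y∈S∖x = ∧⁺ y∈S (≢⇒¬≡ᵇ (λ y≡x → x≢y (sym y≡x)))

  degreeIn-mono : ∀ {G H : Graph n} U v → adj G ⊆ᵍ adj H → degreeIn G U v ≤ degreeIn H U v
  degreeIn-mono U v G⊆H = count-mono _ _ (λ w t → ∧⁺ (∧⁻ˡ t) (G⊆H v w (∧⁻ʳ {U w} t)))

  excess : Graph n → Graph n → ℕ
  excess G H = sumᶠ (λ a → count (λ b → adj H a b ∧ not (adj G a b)))

  module _ {G H : Graph n} {u v : Fin n} (uv : Adj H u v) (¬uv : ¬ Adj G u v) where

    removeEdge-excess : excess G (removeEdge H u v) < excess G H
    removeEdge-excess = sumᶠ-mono-< _ _
      (λ a → count-mono _ _ (λ b t → ∧⁺ (∧⁻ˡ (∧⁻ˡ t)) (∧⁻ʳ {adj (removeEdge H u v) a b} t))) u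
      (count-mono-< _ _ (λ b t → ∧⁺ (∧⁻ˡ (∧⁻ˡ t)) (∧⁻ʳ {adj (removeEdge H u v) u b} t)) v
        (∧⁺ uv (not⁺ ¬uv)) (λ t → not⁻ (∧⁻ʳ {adj H u v} (∧⁻ˡ t)) (∨⁺ˡ (∧⁺ (≡ᵇ-refl u) (≡ᵇ-refl v)))))

    removeEdge-⊇ : adj G ⊆ᵍ adj H → adj G ⊆ᵍ adj (removeEdge H u v)
    removeEdge-⊇ G⊆H a b ab = ∧⁺ (G⊆H a b ab) (not⁺ not-uv)
      where
      not-uv : ¬ T (edgeᵇ u v a b)
      not-uv t with ∨⁻ t
      ... | inj₁ t′ = ¬uv (subst₂ (Adj G) (≡ᵇ⇒≡ (∧⁻ˡ t′)) (≡ᵇ⇒≡ (∧⁻ʳ {a ≡ᵇ u} t′)) ab)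
      ... | inj₂ t′ = ¬uv (Adj-sym G (subst₂ (Adj G) (≡ᵇ⇒≡ (∧⁻ˡ t′)) (≡ᵇ⇒≡ (∧⁻ʳ {a ≡ᵇ v} t′)) ab))

  removeEdge-⊆ : ∀ (H : Graph n) u v a b → Adj H a b → Adj (removeEdge H u v) a b ⊎ IsEdge u v a b
  removeEdge-⊆ H u v a b ab with T? (edgeᵇ u v a b)
  ... | no ¬e = inj₁ (∧⁺ ab (not⁺ ¬e))
  ... | yes e with ∨⁻ e
  ...   | inj₁ t = inj₂ (inj₁ (≡ᵇ⇒≡ (∧⁻ˡ t) , ≡ᵇ⇒≡ (∧⁻ʳ {a ≡ᵇ u} t)))
  ...   | inj₂ t = inj₂ (inj₂ (≡ᵇ⇒≡ (∧⁻ˡ t) , ≡ᵇ⇒≡ (∧⁻ʳ {a ≡ᵇ v} t)))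

  Heavy : Graph n → Graph n → VertexSet n → Set
  Heavy G H U = ∀ a b → Adj H a b → ¬ Adj G a b → T (U a) → T (U b) → count U < degreeIn G U a + degreeIn G U b

  closure : ∀ G H U → adj G ⊆ᵍ adj H → Heavy G H U → HamiltonianConnectedIn H U → HamiltonianConnectedIn G U
  closure G H U = go (excess G H) H ≤-refl
    where
    go : ∀ k H → excess G H ≤ k → adj G ⊆ᵍ adj H → Heavy G H U →
         HamiltonianConnectedIn H U → HamiltonianConnectedIn G U
    go k H bound G⊆H heavy hc with any? (λ a → any? (λ b → T? (adj H a b ∧ not (adj G a b))))
    ... | no none = λ x y x∈U y∈U x≢y → spanning-mono H⊆G (hc x y x∈U y∈U x≢y)
      where
      H⊆G : adj H ⊆ᵍ adj G
      H⊆G a b ab with T? (adj G a b)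
      ... | yes g  = g
      ... | no ¬g = ⊥-elim (none (a , b , ∧⁺ ab (not⁺ ¬g)))
    ... | yes (u , v , extra) = step k (≤-trans (removeEdge-excess {G} {H} uv ¬uv) bound)
      where
      uv : Adj H u v
      uv = ∧⁻ˡ extra
      ¬uv : ¬ Adj G u v
      ¬uv = not⁻ (∧⁻ʳ {adj H u v} extra)
      H′ : Graph n
      H′ = removeEdge H u v
      G⊆H′ : adj G ⊆ᵍ adj H′
      G⊆H′ = removeEdge-⊇ {G} {H} uv ¬uv G⊆H
      step : ∀ k → excess G H′ < k → HamiltonianConnectedIn G U
      step (suc k) bound′ = go k H′ (≤-pred bound′) G⊆H′
        (λ a b ab → heavy a b (∧⁻ˡ ab))
        (λ x y x∈U y∈U x≢y → closure-step H′ H U u v (removeEdge-⊆ H u v)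
           (λ u∈U v∈U → <-≤-trans (heavy u v uv ¬uv u∈U v∈U)
              (+-mono-≤ (degreeIn-mono {G} {H′} U u G⊆H′) (degreeIn-mono {G} {H′} U v G⊆H′)))
           (hc x y x∈U y∈U x≢y))

  ore : ∀ G U → (∀ a b → ¬ Adj G a b → T (U a) → T (U b) → a ≢ b → count U < degreeIn G U a + degreeIn G U b) →
        HamiltonianConnectedIn G U
  ore G U heavy = closure G complete U (λ a b ab → ≢⇒¬≡ᵇ (Adj⇒≢ G ab))
    (λ a b ab ¬g a∈U b∈U → heavy a b ¬g a∈U b∈U (Adj⇒≢ complete ab))
    (clique-spanning {complete} {λ _ → true} (λ a b _ _ a≢b → ≢⇒¬≡ᵇ a≢b) U (λ _ _ → tt))

  addEdges-closure : ∀ G E U →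
    (∀ a b → T (E a b) → ¬ Adj G a b → T (U a) → T (U b) → a ≢ b → count U < degreeIn G U a + degreeIn G U b) →
    HamiltonianConnectedIn (addEdges G E) U → HamiltonianConnectedIn G U
  addEdges-closure G E U heavy = closure G (addEdges G E) U (addEdges-⊇ G E) heavy′
    where
    heavy′ : Heavy G (addEdges G E) U
    heavy′ a b ab ¬g a∈U b∈U with ∨⁻ (∧⁻ʳ {not (a ≡ᵇ b)} ab)
    ... | inj₁ g = ⊥-elim (¬g g)
    ... | inj₂ e with ∨⁻ e
    ...   | inj₁ eab = heavy a b eab ¬g a∈U b∈U (Adj⇒≢ (addEdges G E) ab)
    ...   | inj₂ eba = subst (count U <_) (+-comm (degreeIn G U b) _)
                         (heavy b a eba (¬g ∘ Adj-sym G) b∈U a∈U (Adj⇒≢ (addEdges G E) (Adj-sym (addEdges G E) ab)))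

  elements-singleton : ∀ z → elements (_≡ᵇ z) ≋ z ∷ []
  elements-singleton z = mk≋ λ p → trans (countL-elements (_≡ᵇ z) p)
    (trans (count-cong _ _ (λ w → ∧-comm (w ≡ᵇ z) (p w))) (trans (count-singleton p z) (sym (+-identityʳ _))))

  clique-walk : ∀ {G Q} → IsCliqueᵇ G Q → ∀ F → (∀ w → T (F w) → T (Q w)) →
                ∀ {c y} → T (Q c) → ¬ T (F c) → T (F y) →
                Σ (Walk (adj G) c y) λ w → Walk.steps w ≋ elements F
  clique-walk {G} {Q} cl F F⊆Q {c} {y} c∈Q c∉F y∈F =
    let spanning w enum = clique-spanning {G} {Q} cl S S⊆Q c y (∨⁺ˡ (≡ᵇ-refl c)) (∨⁺ʳ y∈F) c≢y in
    w , ≋-∷⁻ c (≋-trans enum (≋-trans (elements-∨ (_≡ᵇ c) F c-disjoint) (≋-++ (elements-singleton c) ≋-refl)))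
    where
    S : VertexSet _
    S w = (w ≡ᵇ c) ∨ F w
    S⊆Q : ∀ w → T (S w) → T (Q w)
    S⊆Q w w∈S with ∨⁻ w∈S
    ... | inj₁ w≡c = subst (T ∘ Q) (sym (≡ᵇ⇒≡ w≡c)) c∈Q
    ... | inj₂ w∈F = F⊆Q w w∈F
    c-disjoint : ∀ w → T (w ≡ᵇ c) → T (F w) → ⊥
    c-disjoint w w≡c w∈F = c∉F (subst (T ∘ F) (≡ᵇ⇒≡ w≡c) w∈F)
    c≢y : c ≢ y
    c≢y c≡y = c∉F (subst (T ∘ F) (sym c≡y) y∈F)

  split-at : ∀ {R : Fin n → Fin n → Bool} {x y} z L → Chain R x L → lastOf x L ≡ y →
             1 ≤ countL (_≡ᵇ z) (x ∷ L) → z ≢ y →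
             Σ (Walk R x z) λ w₁ → Σ (Fin n) λ s → Σ (Walk R s y) λ w₂ →
               T (R z s) × x ∷ L ≡ Walk.vertices w₁ ++ Walk.vertices w₂
  split-at {R} {x} z L ch end occ z≢y with T? (x ≡ᵇ z) | L | ch
  ... | yes x≡z | []    | _        = ⊥-elim (z≢y (trans (sym (≡ᵇ⇒≡ x≡z)) end))
  ... | yes x≡z | d ∷ L′ | (r , ch′) =
    walk [] tt (≡ᵇ⇒≡ x≡z) , d , walk L′ ch′ end , subst (λ v → T (R v d)) (≡ᵇ⇒≡ x≡z) r , refl
  ... | no  x≢z | []    | _        = ⊥-elim (1+n≰n (subst (λ k → 1 ≤ k + 0) (ind-false x≢z) occ))
  ... | no  x≢z | d ∷ L′ | (r , ch′)
    with split-at z L′ ch′ end (subst (λ k → 1 ≤ k + countL (_≡ᵇ z) (d ∷ L′)) (ind-false x≢z) occ) z≢y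
  ...   | walk L₁ ch₁ end₁ , s , w₂ , zs , eq = walk (d ∷ L₁) (r , ch₁) end₁ , s , w₂ , zs , cong (x ∷_) eq

  module _ {G : Graph n} {Q : VertexSet n} (cl : IsCliqueᵇ G Q) (U F : VertexSet n)
           (F⊆Q : ∀ w → T (F w) → T (Q w)) (F∩U : ∀ w → T (F w) → ¬ T (U w)) where

    private
      disjoint : ∀ w → T (U w) → T (F w) → ⊥
      disjoint w w∈U w∈F = F∩U w w∈F w∈U

    join-clique : ∀ {x k y} → T (Q k) → T (U k) → T (F y) → SpanningPath G U x k →
                  SpanningPath G (λ w → U w ∨ F w) x y
    join-clique k∈Q k∈U y∈F (spanning w enum) =
      let w′ , steps≋F = clique-walk {G} {Q} cl F F⊆Q k∈Q (λ k∈F → F∩U _ k∈F k∈U) y∈F in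
      spanning (append w w′) (≋-trans (≋-++ enum steps≋F) (≋-sym (elements-∨ U F disjoint)))

    -- F is inserted between z and its successor on the path.
    insert-clique : ∀ {x y z} → T (Q z) → T (U z) → (∀ w → Adj G z w → T (U w) → T (Q w)) → z ≢ y →
                    SpanningPath G U x y → SpanningPath G (λ w → U w ∨ F w) x y
    insert-clique {x} {z = z} z∈Q z∈U z-nbrs z≢y (spanning (walk L ch end) enum)
      with split-at z L ch end (subst (1 ≤_) (sym (trans (occurrences enum z) (ind-true z∈U))) ≤-refl) z≢y
    ... | w₁ , s , w₂ , zs , split =
      spanning (append w₁ (append (proj₁ detour) w₂)) (begin
        V₁ ++ Walk.steps (proj₁ detour) ++ S₂       ≈⟨ ≋-++ (≋-refl {xs = V₁}) (≋-++ (proj₂ detour) ≋-refl) ⟩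
        V₁ ++ (elements F+s ++ S₂)                  ≈⟨ ≋-++ (≋-refl {xs = V₁}) (≋-++ (≋-trans (elements-∨ F (_≡ᵇ s) s∉F) (≋-++ (≋-refl {xs = elements F}) (elements-singleton s))) ≋-refl) ⟩
        V₁ ++ ((elements F ++ s ∷ []) ++ S₂)        ≈⟨ ≋-++ (≋-refl {xs = V₁}) (≋-reflexive (++-assoc (elements F) (s ∷ []) S₂)) ⟩
        V₁ ++ (elements F ++ Walk.vertices w₂)      ≈⟨ ≋-++ (≋-refl {xs = V₁}) (≋-++-comm (elements F) _) ⟩
        V₁ ++ (Walk.vertices w₂ ++ elements F)      ≈⟨ ≋-reflexive (trans (sym (++-assoc V₁ _ (elements F))) (cong (_++ elements F) (sym split))) ⟩
        (x ∷ L) ++ elements F                       ≈⟨ ≋-++ enum ≋-refl ⟩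
        elements U ++ elements F                    ≈⟨ ≋-sym (elements-∨ U F disjoint) ⟩
        elements (λ w → U w ∨ F w)                  ∎)
      where
      V₁ S₂ : List (Fin n)
      V₁ = Walk.vertices w₁
      S₂ = Walk.steps w₂
      s∈U : T (U s)
      s∈U = occurs⇒∈ enum (subst (λ l → 1 ≤ countL (_≡ᵇ s) l) (sym split)
              (≤-trans (occurs-head s S₂) (≤-trans (m≤n+m _ (countL (_≡ᵇ s) V₁))
                (≤-reflexive (sym (countL-++ (_≡ᵇ s) V₁ (s ∷ S₂)))))))
      s∉F : ∀ v → T (F v) → T (v ≡ᵇ s) → ⊥
      s∉F v v∈F v≡s = F∩U v v∈F (subst (T ∘ U) (sym (≡ᵇ⇒≡ v≡s)) s∈U)
      F+s : VertexSet n
      F+s v = F v ∨ (v ≡ᵇ s)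
      F+s⊆Q : ∀ v → T (F+s v) → T (Q v)
      F+s⊆Q v v∈F+s with ∨⁻ v∈F+s
      ... | inj₁ v∈F = F⊆Q v v∈F
      ... | inj₂ v≡s = subst (T ∘ Q) (sym (≡ᵇ⇒≡ v≡s)) (z-nbrs s zs s∈U)
      z∉F+s : ¬ T (F+s z)
      z∉F+s t with ∨⁻ t
      ... | inj₁ z∈F = F∩U z z∈F z∈U
      ... | inj₂ z≡s = Adj⇒≢ G zs (≡ᵇ⇒≡ z≡s)
      detour : Σ (Walk (adj G) z s) λ w → Walk.steps w ≋ elements F+s
      detour = clique-walk {G} {Q} cl F+s F+s⊆Q z∈Q z∉F+s (∨⁺ʳ (≡ᵇ-refl s))
      open SetoidReasoning (≋-setoid {Fin n})

absent⇒All≢ : ∀ {n} (c : Fin n) xs → countL (_≡ᵇ c) xs ≡ 0 → All (c ≢_) xs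
absent⇒All≢ c []       _      = All.[]
absent⇒All≢ c (d ∷ xs) absent =
  (λ c≡d → 1+n≢0 (trans (cong (_+ _) (sym (ind-true (≡⇒≡ᵇ (sym c≡d))))) absent)) All.∷
  absent⇒All≢ c xs (m+n≡0⇒n≡0 (ind (d ≡ᵇ c)) absent)

unique-from-counts : ∀ {n} (xs : List (Fin n)) → (∀ w → countL (_≡ᵇ w) xs ≤ 1) → Unique xs
unique-from-counts []       _    = AllPairs.[]
unique-from-counts (c ∷ xs) once =
  absent⇒All≢ c xs (n≤0⇒n≡0 (+-cancelˡ-≤ 1 _ 0 (subst (λ k → k + countL (_≡ᵇ c) xs ≤ 1) (ind-true (≡ᵇ-refl c)) (once c)))) AllPairs.∷
  unique-from-counts xs (λ w → ≤-trans (m≤n+m _ _) (once w))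

occurs⇒∈ˡ : ∀ {n} {w : Fin n} xs → 1 ≤ countL (_≡ᵇ w) xs → w ∈ˡ xs
occurs⇒∈ˡ {w = w} (d ∷ xs) occ with T? (d ≡ᵇ w)
... | yes d≡w = here (sym (≡ᵇ⇒≡ d≡w))
... | no  d≢w = there (occurs⇒∈ˡ xs (subst (λ k → 1 ≤ k + _) (ind-false d≢w) occ))

chain⇒linked : ∀ {A : Set} {R : A → A → Bool} c L → Chain R c L → Linked (λ a b → T (R a b)) (c ∷ L)
chain⇒linked c []      _        = Linked.[-]
chain⇒linked c (d ∷ L) (r , ch) = r Linked.∷ chain⇒linked d L ch

spanning⇒hamiltonian : ∀ {n} (G : Graph n) {x y} → x ≢ y → SpanningPath G (λ _ → true) x y → HamiltonianPath G x y
spanning⇒hamiltonian G {x} x≢y (spanning (walk L ch end) enum) with initLast L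
... | []       = ⊥-elim (x≢y end)
... | ms ∷ʳ′ z with trans (sym (lastOf-++ x ms (z ∷ []))) end
...   | refl =
  ms ,
  unique-from-counts (x ∷ ms ++ z ∷ []) (λ w → ≤-reflexive (occurrences enum w)) ,
  (λ w → occurs⇒∈ˡ (x ∷ ms ++ z ∷ []) (≤-reflexive (sym (occurrences enum w)))) ,
  chain⇒linked x (ms ++ z ∷ []) ch

-- Relabelling vertices

injective⇒surjective : ∀ {n} (f : Fin n → Fin n) → (∀ {u v} → f u ≡ f v → u ≡ v) → ∀ j → ∃ λ i → f i ≡ j
injective⇒surjective {suc m} f inj j with any? (λ i → f i ≟ j)
... | yes found = found
... | no missed = ⊥-elim (1+n≰n (injective⇒≤ {f = g} (λ eq → inj (punchOut-injective (f≢j _) (f≢j _) eq))))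
  where
  f≢j : ∀ i → j ≢ f i
  f≢j i j≡fi = missed (i , sym j≡fi)
  g : Fin (suc m) → Fin m
  g i = punchOut (f≢j i)

-- Listing the vertices by increasing class c, ties broken by index.
module SortByClass {n : ℕ} (c : Fin n → ℕ) where

  key : Fin n → ℕ
  key v = c v * n + toℕ v

  key-< : ∀ {u v} → c u < c v → key u < key v
  key-< {u} {v} cu<cv = begin-strict
    c u * n + toℕ u  <⟨ +-monoʳ-< (c u * n) (toℕ<n u) ⟩
    c u * n + n      ≡⟨ +-comm (c u * n) n ⟩
    suc (c u) * n    ≤⟨ *-monoˡ-≤ n cu<cv ⟩
    c v * n          ≤⟨ m≤m+n (c v * n) (toℕ v) ⟩
    key v            ∎
    where open ≤-Reasoning

  key-injective : ∀ {u v} → key u ≡ key v → u ≡ v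
  key-injective {u} {v} eq with <-cmp (c u) (c v)
  ... | tri< cu<cv _ _ = ⊥-elim (<-irrefl eq (key-< cu<cv))
  ... | tri> _ _ cv<cu = ⊥-elim (<-irrefl (sym eq) (key-< cv<cu))
  ... | tri≈ _ cu≡cv _ = toℕ-injective (+-cancelˡ-≡ (c u * n) _ _ (trans eq (cong (λ k → k * n + toℕ v) (sym cu≡cv))))

  rank : Fin n → ℕ
  rank v = count (λ u → key u <ᵇ key v)

  rank-< : ∀ {u v} → key u < key v → rank u < rank v
  rank-< {u} {v} ku<kv = count-mono-< _ _ (λ w kw<ku → <⇒<ᵇ (<-trans (<ᵇ⇒< (key w) (key u) kw<ku) ku<kv)) u (<⇒<ᵇ ku<kv)
                           (λ ku<ku → <-irrefl refl (<ᵇ⇒< (key u) (key u) ku<ku))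

  rank-injective : ∀ {u v} → rank u ≡ rank v → u ≡ v
  rank-injective {u} {v} eq with <-cmp (key u) (key v)
  ... | tri< ku<kv _ _ = ⊥-elim (<-irrefl eq (rank-< ku<kv))
  ... | tri≈ _ ku≡kv _ = key-injective ku≡kv
  ... | tri> _ _ kv<ku = ⊥-elim (<-irrefl (sym eq) (rank-< kv<ku))

  rank<n : ∀ v → rank v < n
  rank<n v = subst (rank v <_) (count-true {n})
    (count-mono-< _ _ (λ _ _ → tt) v tt (λ kv<kv → <-irrefl refl (<ᵇ⇒< (key v) (key v) kv<kv)))

  rank-threshold : ∀ k v → (rank v <ᵇ count (λ u → c u ≤ᵇ k)) ≡ (c v ≤ᵇ k)
  rank-threshold k v = T-injective (λ t → ≤⇒≤ᵇ (low (<ᵇ⇒< (rank v) _ t))) (λ t → <⇒<ᵇ (high (≤ᵇ⇒≤ (c v) k t)))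
    where
    high : c v ≤ k → rank v < count (λ u → c u ≤ᵇ k)
    high cv≤k = count-mono-< _ _
      (λ u ku<kv → ≤⇒≤ᵇ (≤-trans (≮⇒≥ (λ cv<cu → <-asym (<ᵇ⇒< (key u) (key v) ku<kv) (key-< cv<cu))) cv≤k)) v (≤⇒≤ᵇ cv≤k)
      (λ kv<kv → <-irrefl refl (<ᵇ⇒< (key v) (key v) kv<kv))
    low : rank v < count (λ u → c u ≤ᵇ k) → c v ≤ k
    low r< = ≮⇒≥ (λ k<cv → <⇒≱ r< (count-mono _ _ (λ u cu≤k → <⇒<ᵇ (key-< (≤-<-trans (≤ᵇ⇒≤ (c u) k cu≤k) k<cv)))))

  σ : Fin n → Fin n
  σ v = fromℕ< (rank<n v)

  σ-injective : ∀ {u v} → σ u ≡ σ v → u ≡ v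
  σ-injective {u} {v} eq = rank-injective (trans (sym (toℕ-fromℕ< (rank<n u))) (trans (cong toℕ eq) (toℕ-fromℕ< (rank<n v))))

  σ-surjective : ∀ j → ∃ λ i → σ i ≡ j
  σ-surjective = injective⇒surjective σ σ-injective

abstract
  sort-by-class : ∀ {n} (c : Fin n → ℕ) →
    Σ (Fin n ↔ Fin n) λ σ → ∀ k v → (toℕ (Inverse.to σ v) <ᵇ count (λ u → c u ≤ᵇ k)) ≡ (c v ≤ᵇ k)
  sort-by-class c =
    mk↔ₛ′ σ (proj₁ ∘ σ-surjective) (proj₂ ∘ σ-surjective) (λ v → σ-injective (proj₂ (σ-surjective (σ v)))) ,
    λ k v → trans (cong (_<ᵇ count (λ u → c u ≤ᵇ k)) (toℕ-fromℕ< (rank<n v))) (rank-threshold k v)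
    where open SortByClass c

neq-injective : ∀ {n} (f : Fin n → Fin n) → (∀ {u v} → f u ≡ f v → u ≡ v) → ∀ u v → neq (f u) (f v) ≡ neq u v
neq-injective f f-injective u v with f u ≟ f v | u ≟ v
... | yes _       | yes _   = refl
... | no  _       | no  _   = refl
... | yes fu≡fv   | no  u≢v = ⊥-elim (u≢v (f-injective fu≡fv))
... | no  fu≢fv   | yes u≡v = ⊥-elim (fu≢fv (cong f u≡v))

neq⁺ : ∀ {n} {u v : Fin n} → u ≢ v → T (neq u v)
neq⁺ {u = u} {v} u≢v with u ≟ v
... | yes u≡v = u≢v u≡v
... | no  _   = tt

neq⁻ : ∀ {n} {u v : Fin n} → T (neq u v) → u ≢ v
neq⁻ {u = u} {v} t with u ≟ v
... | yes u≡v = λ _ → t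
... | no  u≢v = u≢v

-- A graph with a clique K of size ω and n < δ + ω

module Argument {n : ℕ} (G : Graph n) (δ ω : ℕ) (K : VertexSet n)
  (K-clique : IsCliqueᵇ G K) (|K|≡ω : count K ≡ ω)
  (δ≤degree : ∀ v → δ ≤ count (adj G v)) (n<δ+ω : n + 1 ≤ δ + ω) where

  everything : VertexSet n
  everything _ = true

  R : VertexSet n
  R v = not (K v)

  r : ℕ
  r = count R

  n≡ω+r : n ≡ ω + r
  n≡ω+r = trans (sym (count-true {n})) (trans (count-split everything K) (cong (_+ r) |K|≡ω))

  r<δ : r < δ
  r<δ = +-cancelˡ-≤ ω (suc r) δ (begin
    ω + suc r  ≡⟨ +-suc ω r ⟩
    suc ω + r  ≡⟨ cong suc (sym n≡ω+r) ⟩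
    suc n      ≡⟨ +-comm 1 n ⟩
    n + 1      ≤⟨ n<δ+ω ⟩
    δ + ω      ≡⟨ +-comm δ ω ⟩
    ω + δ      ∎)
    where open ≤-Reasoning

  K-R-≢ : ∀ {a b} → T (K a) → T (R b) → a ≢ b
  K-R-≢ a∈K b∈R refl = not⁻ b∈R a∈K

  hc-if-n<2δ : n < δ + δ → HamiltonianConnectedIn G everything
  hc-if-n<2δ n<2δ = ore G everything (λ a b _ _ _ _ →
    subst (_< degreeIn G everything a + degreeIn G everything b) (sym (count-true {n}))
          (≤-trans n<2δ (+-mono-≤ (δ≤degree a) (δ≤degree b))))

  hc-if-R-empty : (∀ v → ¬ T (R v)) → HamiltonianConnectedIn G everything
  hc-if-R-empty R-empty = ore G everything (λ a b ¬ab _ _ a≢b → ⊥-elim (¬ab (K-clique a b (in-K a) (in-K b) a≢b)))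
    where
    in-K : ∀ v → T (K v)
    in-K v with T? (K v)
    ... | yes v∈K = v∈K
    ... | no  v∉K = ⊥-elim (R-empty v (not⁺ v∉K))

  hasOutsideNeighbour : VertexSet n
  hasOutsideNeighbour v = does (any? (λ s → T? (R s ∧ adj G v s)))

  K₁ K₀ : VertexSet n
  K₁ v = K v ∧ hasOutsideNeighbour v
  K₀ v = K v ∧ not (hasOutsideNeighbour v)

  ω₁ : ℕ
  ω₁ = count K₁

  K₁-intro : ∀ {s v} → T (R s) → Adj G s v → T (K v) → T (K₁ v)
  K₁-intro {s} {v} s∈R sv v∈K = ∧⁺ v∈K (does⁺ (any? (λ s → T? (R s ∧ adj G v s))) (s , ∧⁺ s∈R (Adj-sym G sv)))

  K₁-outside-neighbour : ∀ {v} → T (K₁ v) → ∃ λ s → T (R s) × Adj G v s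
  K₁-outside-neighbour {v} v∈K₁ =
    let s , t = does⁻ (any? (λ s → T? (R s ∧ adj G v s))) (∧⁻ʳ {K v} v∈K₁) in s , ∧⁻ˡ t , ∧⁻ʳ {R s} t

  K₀⇒¬K₁ : ∀ {v} → T (K₀ v) → ¬ T (K₁ v)
  K₀⇒¬K₁ {v} v∈K₀ v∈K₁ = not⁻ (∧⁻ʳ {K v} v∈K₀) (∧⁻ʳ {K v} v∈K₁)

  K∖K₁⇒K₀ : ∀ {v} → T (K v) → ¬ T (K₁ v) → T (K₀ v)
  K∖K₁⇒K₀ v∈K v∉K₁ = ∧⁺ v∈K (not⁺ (λ t → v∉K₁ (∧⁺ v∈K t)))

  K₀-neighbours-in-K : ∀ {z w} → T (K₀ z) → Adj G z w → T (K w)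
  K₀-neighbours-in-K {z} {w} z∈K₀ zw with T? (K w)
  ... | yes w∈K = w∈K
  ... | no  w∉K = ⊥-elim (K₀⇒¬K₁ z∈K₀ (∧⁺ (∧⁻ˡ z∈K₀) (does⁺ (any? (λ s → T? (R s ∧ adj G z s))) (w , ∧⁺ (not⁺ w∉K) zw))))

  degree-split : ∀ s → count (adj G s) ≡ degreeIn G K s + degreeIn G R s
  degree-split s = trans (count-split (adj G s) K)
    (cong₂ _+_ (count-cong _ _ (λ w → ∧-comm (adj G s w) (K w))) (count-cong _ _ (λ w → ∧-comm (adj G s w) (R w))))

  module _ {s : Fin n} (s∈R : T (R s)) where

    outside-degree : suc r ≤ degreeIn G K s + degreeIn G R s
    outside-degree = ≤-trans r<δ (≤-trans (δ≤degree s) (≤-reflexive (degree-split s)))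

    K-neighbours-in-K₁ : degreeIn G K s ≤ ω₁
    K-neighbours-in-K₁ = count-mono _ _ (λ v t → K₁-intro s∈R (∧⁻ʳ {K v} t) (∧⁻ˡ t))

    R-neighbours<r : degreeIn G R s < r
    R-neighbours<r = subst (degreeIn G R s <_) (sym (count-remove R s s∈R))
      (s≤s (count-mono _ _ (λ v t → ∧⁺ (∧⁻ˡ t) (≢⇒¬≡ᵇ (λ v≡s → Adj⇒≢ G (∧⁻ʳ {R v} t) (sym v≡s))))))

    two-K-neighbours : 2 ≤ degreeIn G K s
    two-K-neighbours = +-cancelʳ-≤ (degreeIn G R s) 2 _ (≤-trans (s≤s R-neighbours<r) outside-degree)

    ω₁≥2 : 2 ≤ ω₁
    ω₁≥2 = ≤-trans two-K-neighbours K-neighbours-in-K₁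

  -- Outside vertices keep their full degree in an admissible U.
  record Admissible (U : VertexSet n) : Set where
    field
      R⊆U            : ∀ {s} → T (R s) → T (U s)
      R-neighbours⊆U : ∀ {s w} → T (R s) → Adj G s w → T (U w)

    K₁⊆U : ∀ {v} → T (K₁ v) → T (U v)
    K₁⊆U v∈K₁ = let s , s∈R , vs = K₁-outside-neighbour v∈K₁ in R-neighbours⊆U s∈R (Adj-sym G vs)

  count≤K∩U+r : ∀ U → count U ≤ count (λ w → K w ∧ U w) + r
  count≤K∩U+r U = subst (_≤ count (λ w → K w ∧ U w) + r) (sym (count-split U K))
    (+-mono-≤ (≤-reflexive (count-cong _ _ (λ w → ∧-comm (U w) (K w)))) (count-mono _ _ (λ w t → ∧⁻ʳ {U w} t)))

  G₁ : Graph n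
  G₁ = addEdges G (λ a b → K₁ a ∧ R b)

  G⊆G₁ : adj G ⊆ᵍ adj G₁
  G⊆G₁ = addEdges-⊇ G (λ a b → K₁ a ∧ R b)

  K₁-universal : ∀ {k a} → T (K₁ k) → k ≢ a → Adj G₁ k a
  K₁-universal {k} {a} k∈K₁ k≢a with T? (K a)
  ... | yes a∈K = G⊆G₁ k a (K-clique k a (∧⁻ˡ k∈K₁) a∈K k≢a)
  ... | no  a∉K = ∧⁺ (≢⇒¬≡ᵇ k≢a) (∨⁺ʳ {adj G k a} (∨⁺ˡ (∧⁺ k∈K₁ (not⁺ a∉K))))

  module _ {U : VertexSet n} (adm : Admissible U) where

    open Admissible adm

    K₁-degree : ∀ {H a} → adj G₁ ⊆ᵍ adj H → ¬ T (K₁ a) → ω₁ ≤ degreeIn H U a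
    K₁-degree {H} {a} G₁⊆H a∉K₁ = count-mono _ _ (λ k k∈K₁ →
      ∧⁺ (K₁⊆U k∈K₁) (G₁⊆H a k (Adj-sym G₁ (K₁-universal k∈K₁ (λ k≡a → a∉K₁ (subst (T ∘ K₁) k≡a k∈K₁))))))

    stage₁ : HamiltonianConnectedIn G₁ U → HamiltonianConnectedIn G U
    stage₁ = addEdges-closure G _ U heavy
      where
      heavy : ∀ a b → T (K₁ a ∧ R b) → ¬ Adj G a b → T (U a) → T (U b) → a ≢ b →
              count U < degreeIn G U a + degreeIn G U b
      heavy a b e _ a∈U b∈U _ = begin-strict
        count U                                    ≤⟨ count≤K∩U+r U ⟩
        count (λ w → K w ∧ U w) + r                <⟨ +-monoʳ-< _ r<δ ⟩
        count (λ w → K w ∧ U w) + δ                ≤⟨ +-mono-≤ K∩U≤degree δ≤degree-b ⟩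
        degreeIn G U a + degreeIn G U b            ∎
        where
        open ≤-Reasoning
        a∈K₁ : T (K₁ a)
        a∈K₁ = ∧⁻ˡ e
        s : Fin n
        s = proj₁ (K₁-outside-neighbour a∈K₁)
        s∈R : T (R s)
        s∈R = proj₁ (proj₂ (K₁-outside-neighbour a∈K₁))
        as : Adj G a s
        as = proj₂ (proj₂ (K₁-outside-neighbour a∈K₁))
        -- a loses itself from K ∩ U but gains its outside neighbour s
        K∩U≤degree : count (λ w → K w ∧ U w) ≤ degreeIn G U a
        K∩U≤degree = begin
          count (λ w → K w ∧ U w)                                 ≡⟨ count-remove _ a (∧⁺ (∧⁻ˡ a∈K₁) a∈U) ⟩
          suc (count (λ w → (K w ∧ U w) ∧ not (w ≡ᵇ a)))           ≡⟨ trans (+-comm 1 _) (cong (_ +_) (sym (count-≡ᵇ s))) ⟩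
          count (λ w → (K w ∧ U w) ∧ not (w ≡ᵇ a)) + count (_≡ᵇ s) ≡⟨ count-∨ (λ w → (K w ∧ U w) ∧ not (w ≡ᵇ a)) (_≡ᵇ s)
                                                                         (λ w t w≡s → not⁻ (subst (T ∘ R) (sym (≡ᵇ⇒≡ w≡s)) s∈R) (∧⁻ˡ (∧⁻ˡ t))) ⟨
          count (λ w → ((K w ∧ U w) ∧ not (w ≡ᵇ a)) ∨ (w ≡ᵇ s))    ≤⟨ count-mono _ _ neighbour ⟩
          degreeIn G U a                                          ∎
          where
          neighbour : ∀ w → T (((K w ∧ U w) ∧ not (w ≡ᵇ a)) ∨ (w ≡ᵇ s)) → T (U w ∧ adj G a w)
          neighbour w t with ∨⁻ t
          ... | inj₁ t′ = ∧⁺ (∧⁻ʳ {K w} (∧⁻ˡ t′))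
                             (K-clique a w (∧⁻ˡ a∈K₁) (∧⁻ˡ (∧⁻ˡ t′)) (λ a≡w → not⁻ (∧⁻ʳ {K w ∧ U w} t′) (≡⇒≡ᵇ (sym a≡w))))
          ... | inj₂ w≡s = subst (λ x → T (U x ∧ adj G a x)) (sym (≡ᵇ⇒≡ w≡s)) (∧⁺ (R⊆U s∈R) as)
        δ≤degree-b : δ ≤ degreeIn G U b
        δ≤degree-b = ≤-trans (δ≤degree b) (count-mono (adj G b) _ (λ w bw → ∧⁺ (R-neighbours⊆U (∧⁻ʳ {K₁ a} e) bw) bw))

  hc-by-K₁-degrees : ∀ U → Admissible U → count U < ω₁ + ω₁ → HamiltonianConnectedIn G U
  hc-by-K₁-degrees U adm small = stage₁ adm (ore G₁ U heavy)
    where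
    heavy : ∀ a b → ¬ Adj G₁ a b → T (U a) → T (U b) → a ≢ b → count U < degreeIn G₁ U a + degreeIn G₁ U b
    heavy a b ¬ab _ _ a≢b = <-≤-trans small (+-mono-≤
      (K₁-degree adm {G₁} (λ _ _ t → t) (λ a∈K₁ → ¬ab (K₁-universal a∈K₁ a≢b)))
      (K₁-degree adm {G₁} (λ _ _ t → t) (λ b∈K₁ → ¬ab (Adj-sym G₁ (K₁-universal b∈K₁ (λ b≡a → a≢b (sym b≡a)))))))

  module _ {U : VertexSet n} (adm : Admissible U) where

    open Admissible adm

    K₁-and-one-more : ∀ {H a} t → adj G₁ ⊆ᵍ adj H → ¬ T (K₁ a) → ¬ T (K₁ t) → T (U t) → Adj H a t →
                      suc ω₁ ≤ degreeIn H U a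
    K₁-and-one-more {H} {a} t G₁⊆H a∉K₁ t∉K₁ t∈U at = begin
      suc ω₁                                 ≡⟨ trans (+-comm 1 ω₁) (cong (ω₁ +_) (sym (count-≡ᵇ t))) ⟩
      ω₁ + count (_≡ᵇ t)                     ≡⟨ count-∨ K₁ (_≡ᵇ t) (λ w w∈K₁ w≡t → t∉K₁ (subst (T ∘ K₁) (≡ᵇ⇒≡ w≡t) w∈K₁)) ⟨
      count (λ w → K₁ w ∨ (w ≡ᵇ t))          ≤⟨ count-mono _ _ neighbour ⟩
      degreeIn H U a                         ∎
      where
      open ≤-Reasoning
      neighbour : ∀ w → T (K₁ w ∨ (w ≡ᵇ t)) → T (U w ∧ adj H a w)
      neighbour w t′ with ∨⁻ t′
      ... | inj₁ w∈K₁ = ∧⁺ (K₁⊆U w∈K₁) (G₁⊆H a w (Adj-sym G₁ (K₁-universal w∈K₁ (λ w≡a → a∉K₁ (subst (T ∘ K₁) w≡a w∈K₁)))))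
      ... | inj₂ w≡t  = subst (λ x → T (U x ∧ adj H a x)) (sym (≡ᵇ⇒≡ w≡t)) (∧⁺ t∈U at)

    outside-degree₁ : ∀ {H s} → adj G₁ ⊆ᵍ adj H → T (R s) → ω₁ + degreeIn G R s ≤ degreeIn H U s
    outside-degree₁ {H} {s} G₁⊆H s∈R = begin
      ω₁ + degreeIn G R s                          ≡⟨ count-∨ K₁ _ (λ w w∈K₁ t → not⁻ (∧⁻ˡ {not (K w)} t) (∧⁻ˡ {K w} w∈K₁)) ⟨
      count (λ w → K₁ w ∨ (R w ∧ adj G s w))       ≤⟨ count-mono _ _ neighbour ⟩
      degreeIn H U s                               ∎
      where
      open ≤-Reasoning
      neighbour : ∀ w → T (K₁ w ∨ (R w ∧ adj G s w)) → T (U w ∧ adj H s w)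
      neighbour w t with ∨⁻ t
      ... | inj₁ w∈K₁ = ∧⁺ (K₁⊆U w∈K₁) (G₁⊆H s w (Adj-sym G₁ (K₁-universal w∈K₁ (K-R-≢ (∧⁻ˡ w∈K₁) s∈R))))
      ... | inj₂ t′   = ∧⁺ (R⊆U (∧⁻ˡ t′)) (G₁⊆H s w (G⊆G₁ s w (∧⁻ʳ {R w} t′)))

    R⇒¬K₁ : ∀ {t} → T (R t) → ¬ T (K₁ t)
    R⇒¬K₁ t∈R t∈K₁ = not⁻ t∈R (∧⁻ˡ t∈K₁)

    non-K₁-pair : ∀ {H a b} → adj G₁ ⊆ᵍ adj H → ¬ Adj H a b → a ≢ b → ¬ T (K₁ a) × ¬ T (K₁ b)
    non-K₁-pair G₁⊆H ¬ab a≢b =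
      (λ a∈K₁ → ¬ab (G₁⊆H _ _ (K₁-universal a∈K₁ a≢b))) ,
      (λ b∈K₁ → ¬ab (G₁⊆H _ _ (Adj-sym G₁ (K₁-universal b∈K₁ (λ b≡a → a≢b (sym b≡a))))))

    hc-with-outside-edge : count U ≤ suc (ω₁ + r) → ω₁ ≡ suc r → ∀ {t₀ t₁} → T (R t₀) → T (R t₁) → Adj G t₀ t₁ →
                      HamiltonianConnectedIn G U
    hc-with-outside-edge small ω₁≡1+r {t₀} {t₁} t₀∈R t₁∈R t₀t₁ =
      stage₁ adm (addEdges-closure G₁ E₂ U heavy₂ (ore G₂ U heavy₃))
      where
      E₂ : Fin n → Fin n → Bool
      E₂ a b = not (K₁ a) ∧ (b ≡ᵇ t₀)
      G₂ : Graph n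
      G₂ = addEdges G₁ E₂
      |U|≤2ω₁ : count U ≤ ω₁ + ω₁
      |U|≤2ω₁ = ≤-trans small (≤-reflexive (trans (sym (+-suc ω₁ r)) (cong (ω₁ +_) (sym ω₁≡1+r))))
      t₀-degree : ∀ {H} → adj G₁ ⊆ᵍ adj H → suc ω₁ ≤ degreeIn H U t₀
      t₀-degree {H} G₁⊆H = K₁-and-one-more {H} t₁ G₁⊆H (R⇒¬K₁ t₀∈R) (R⇒¬K₁ t₁∈R) (R⊆U t₁∈R) (G₁⊆H _ _ (G⊆G₁ _ _ t₀t₁))
      heavy₂ : ∀ a b → T (E₂ a b) → ¬ Adj G₁ a b → T (U a) → T (U b) → a ≢ b →
               count U < degreeIn G₁ U a + degreeIn G₁ U b
      heavy₂ a b e _ _ _ _ = subst (λ x → count U < degreeIn G₁ U a + degreeIn G₁ U x) (sym (≡ᵇ⇒≡ (∧⁻ʳ {not (K₁ a)} e)))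
        (≤-trans (s≤s |U|≤2ω₁) (≤-trans (≤-reflexive (sym (+-suc ω₁ ω₁)))
          (+-mono-≤ (K₁-degree adm {G₁} (λ _ _ t → t) (not⁻ (∧⁻ˡ e))) (t₀-degree {G₁} (λ _ _ t → t)))))
      non-K₁-degree : ∀ {a} → ¬ T (K₁ a) → suc ω₁ ≤ degreeIn G₂ U a
      non-K₁-degree {a} a∉K₁ = by-cases (a ≟ t₀)
        where
        by-cases : Dec (a ≡ t₀) → suc ω₁ ≤ degreeIn G₂ U a
        by-cases (yes a≡t₀) = subst (λ x → suc ω₁ ≤ degreeIn G₂ U x) (sym a≡t₀) (t₀-degree {G₂} (addEdges-⊇ G₁ E₂))
        by-cases (no  a≢t₀) = K₁-and-one-more {G₂} t₀ (addEdges-⊇ G₁ E₂) a∉K₁ (R⇒¬K₁ t₀∈R) (R⊆U t₀∈R)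
          (∧⁺ (≢⇒¬≡ᵇ a≢t₀) (∨⁺ʳ {adj G₁ a t₀} (∨⁺ˡ (∧⁺ (not⁺ a∉K₁) (≡ᵇ-refl t₀)))))
      heavy₃ : ∀ a b → ¬ Adj G₂ a b → T (U a) → T (U b) → a ≢ b → count U < degreeIn G₂ U a + degreeIn G₂ U b
      heavy₃ a b ¬ab _ _ a≢b =
        let a∉K₁ , b∉K₁ = non-K₁-pair {G₂} (addEdges-⊇ G₁ E₂) ¬ab a≢b in
        ≤-trans (s≤s (≤-trans |U|≤2ω₁ (+-monoʳ-≤ ω₁ (n≤1+n ω₁)))) (+-mono-≤ (non-K₁-degree a∉K₁) (non-K₁-degree b∉K₁))

    module Case-3≤ω₁≤r (z : Fin n) (outside-K₁ : ∀ {a} → T (U a) → ¬ T (K₁ a) → T (R a) ⊎ a ≡ z)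
                       (small : count U ≤ suc (ω₁ + r)) (3≤ω₁ : 3 ≤ ω₁) (ω₁≤r : ω₁ ≤ r) where

      E₂ : Fin n → Fin n → Bool
      E₂ a b = R a ∧ R b
      G₂ : Graph n
      G₂ = addEdges G₁ E₂

      has-R-neighbour : ∀ {s} → T (R s) → 1 ≤ degreeIn G R s
      has-R-neighbour s∈R = +-cancelˡ-≤ r 1 _ (begin
        r + 1                               ≡⟨ +-comm r 1 ⟩
        suc r                               ≤⟨ outside-degree s∈R ⟩
        degreeIn G K _ + degreeIn G R _     ≤⟨ +-monoˡ-≤ _ (≤-trans (K-neighbours-in-K₁ s∈R) ω₁≤r) ⟩
        r + degreeIn G R _                  ∎)
        where open ≤-Reasoning

      heavy₂ : ∀ a b → T (E₂ a b) → ¬ Adj G₁ a b → T (U a) → T (U b) → a ≢ b →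
               count U < degreeIn G₁ U a + degreeIn G₁ U b
      heavy₂ a b e _ _ _ _ = begin-strict
        count U                                 ≤⟨ small ⟩
        suc (ω₁ + r)                            <⟨ s≤s (≤-reflexive (trans (cong suc (+-comm ω₁ r)) (sym (+-suc r ω₁)))) ⟩
        suc r + suc ω₁                          ≤⟨ +-mono-≤ (≤-trans (outside-degree a∈R) (+-monoˡ-≤ _ (K-neighbours-in-K₁ a∈R)))
                                                            (≤-reflexive (+-comm 1 ω₁)) ⟩
        (ω₁ + degreeIn G R a) + (ω₁ + 1)        ≤⟨ +-mono-≤ (outside-degree₁ {G₁} (λ _ _ t → t) a∈R)
                                                            (≤-trans (+-monoʳ-≤ ω₁ (has-R-neighbour b∈R)) (outside-degree₁ {G₁} (λ _ _ t → t) b∈R)) ⟩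
        degreeIn G₁ U a + degreeIn G₁ U b       ∎
        where
        open ≤-Reasoning
        a∈R : T (R a)
        a∈R = ∧⁻ˡ e
        b∈R : T (R b)
        b∈R = ∧⁻ʳ {R a} e

      R-degree₂ : ∀ {s} → T (R s) → ω₁ + count (R ∖ s) ≤ degreeIn G₂ U s
      R-degree₂ {s} s∈R = begin
        ω₁ + count (R ∖ s)                  ≡⟨ count-∨ K₁ (R ∖ s) (λ w w∈K₁ t → R⇒¬K₁ (∧⁻ˡ t) w∈K₁) ⟨
        count (λ w → K₁ w ∨ (R ∖ s) w)      ≤⟨ count-mono _ _ neighbour ⟩
        degreeIn G₂ U s                     ∎
        where
        open ≤-Reasoning
        neighbour : ∀ w → T (K₁ w ∨ (R ∖ s) w) → T (U w ∧ adj G₂ s w)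
        neighbour w t with ∨⁻ t
        ... | inj₁ w∈K₁ = ∧⁺ (K₁⊆U w∈K₁) (addEdges-⊇ G₁ E₂ s w (Adj-sym G₁ (K₁-universal w∈K₁ (K-R-≢ (∧⁻ˡ w∈K₁) s∈R))))
        ... | inj₂ t′   = ∧⁺ (R⊆U (∧⁻ˡ t′)) (∧⁺ (≢⇒¬≡ᵇ {u = s} {v = w} (λ s≡w → not⁻ (∧⁻ʳ {R w} t′) (≡⇒≡ᵇ {u = w} (sym s≡w))))
                                              (∨⁺ʳ {adj G₁ s w} (∨⁺ˡ (∧⁺ s∈R (∧⁻ˡ t′)))))

      outside-and-z : ∀ {s} → T (R s) → ¬ T (K₁ z) → count U < degreeIn G₂ U s + degreeIn G₂ U z
      outside-and-z {s} s∈R z∉K₁ = begin-strict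
        count U                                  ≤⟨ small ⟩
        suc (ω₁ + r)                             ≡⟨ cong (λ k → suc (ω₁ + k)) (count-remove R s s∈R) ⟩
        suc (ω₁ + suc (count (R ∖ s)))           <⟨ arithmetic ⟩
        (ω₁ + count (R ∖ s)) + ω₁                ≤⟨ +-mono-≤ (R-degree₂ s∈R) (K₁-degree adm {G₂} (addEdges-⊇ G₁ E₂) z∉K₁) ⟩
        degreeIn G₂ U s + degreeIn G₂ U z        ∎
        where
        open ≤-Reasoning
        arithmetic : suc (ω₁ + suc (count (R ∖ s))) < (ω₁ + count (R ∖ s)) + ω₁
        arithmetic = ≤-trans (≤-reflexive (solve 2 (λ w c → con 2 :+ (w :+ (con 1 :+ c)) := (w :+ c) :+ con 3) refl ω₁ (count (R ∖ s))))
                             (+-monoʳ-≤ (ω₁ + count (R ∖ s)) 3≤ω₁)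
          where open +-*-Solver using (solve; _:+_; _:=_; con)

      heavy₃ : ∀ a b → ¬ Adj G₂ a b → T (U a) → T (U b) → a ≢ b → count U < degreeIn G₂ U a + degreeIn G₂ U b
      heavy₃ a b ¬ab a∈U b∈U a≢b with non-K₁-pair {G₂} (addEdges-⊇ G₁ E₂) ¬ab a≢b
      ... | a∉K₁ , b∉K₁ with outside-K₁ a∈U a∉K₁ | outside-K₁ b∈U b∉K₁
      ... | inj₁ a∈R  | inj₁ b∈R  = ⊥-elim (¬ab (∧⁺ (≢⇒¬≡ᵇ a≢b) (∨⁺ʳ {adj G₁ a b} (∨⁺ˡ (∧⁺ a∈R b∈R)))))
      ... | inj₁ a∈R  | inj₂ refl = outside-and-z a∈R b∉K₁
      ... | inj₂ refl | inj₁ b∈R  = subst (count U <_) (+-comm (degreeIn G₂ U b) _) (outside-and-z b∈R a∉K₁)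
      ... | inj₂ refl | inj₂ refl = ⊥-elim (a≢b refl)

      hc : HamiltonianConnectedIn G U
      hc = stage₁ adm (addEdges-closure G₁ E₂ U heavy₂ (ore G₂ U heavy₃))

    hc-if-3≤ω₁≤r : ∀ z → (∀ {a} → T (U a) → ¬ T (K₁ a) → T (R a) ⊎ a ≡ z) → count U ≤ suc (ω₁ + r) →
                   3 ≤ ω₁ → ω₁ ≤ r → HamiltonianConnectedIn G U
    hc-if-3≤ω₁≤r = Case-3≤ω₁≤r.hc

  -- The other vertices of K₀ are spliced back in through the clique K.
  U[_] : Fin n → VertexSet n
  U[ z ] w = not (K₀ w) ∨ (w ≡ᵇ z)

  K₀∖_ : Fin n → VertexSet n
  (K₀∖ z) w = K₀ w ∧ not (w ≡ᵇ z)

  U-admissible : ∀ z → Admissible U[ z ]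
  U-admissible z = record
    { R⊆U            = λ s∈R → ∨⁺ˡ (not⁺ (λ s∈K₀ → not⁻ s∈R (∧⁻ˡ s∈K₀)))
    ; R-neighbours⊆U = λ s∈R sw → ∨⁺ˡ (not⁺ (λ w∈K₀ → not⁻ s∈R (K₀-neighbours-in-K w∈K₀ (Adj-sym G sw))))
    }

  U-outside-K₁ : ∀ z {a} → T (U[ z ] a) → ¬ T (K₁ a) → T (R a) ⊎ a ≡ z
  U-outside-K₁ z {a} a∈U a∉K₁ with T? (K a) | ∨⁻ a∈U
  ... | no  a∉K | _         = inj₁ (not⁺ a∉K)
  ... | yes a∈K | inj₁ a∉K₀ = ⊥-elim (not⁻ a∉K₀ (K∖K₁⇒K₀ a∈K a∉K₁))
  ... | yes _   | inj₂ a≡z  = inj₂ (≡ᵇ⇒≡ a≡z)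

  |U[_]| : ∀ z → count U[ z ] ≤ suc (ω₁ + r)
  |U[ z ]| = begin
    count U[ z ]                              ≤⟨ count≤K∩U+r U[ z ] ⟩
    count (λ w → K w ∧ U[ z ] w) + r          ≤⟨ +-monoˡ-≤ r (count-mono _ _ K∩U⊆K₁+z) ⟩
    count (λ w → K₁ w ∨ (w ≡ᵇ z)) + r         ≤⟨ +-monoˡ-≤ r (count-∨-≤ K₁ (_≡ᵇ z)) ⟩
    (ω₁ + count (_≡ᵇ z)) + r                  ≡⟨ cong (λ k → (ω₁ + k) + r) (count-≡ᵇ z) ⟩
    (ω₁ + 1) + r                              ≡⟨ cong (_+ r) (+-comm ω₁ 1) ⟩
    suc (ω₁ + r)                              ∎
    where
    open ≤-Reasoning
    K∩U⊆K₁+z : ∀ w → T (K w ∧ U[ z ] w) → T (K₁ w ∨ (w ≡ᵇ z))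
    K∩U⊆K₁+z w t with T? (K₁ w) | ∨⁻ (∧⁻ʳ {K w} t)
    ... | yes w∈K₁ | _         = ∨⁺ˡ w∈K₁
    ... | no  w∉K₁ | inj₁ w∉K₀ = ⊥-elim (not⁻ w∉K₀ (K∖K₁⇒K₀ (∧⁻ˡ t) w∉K₁))
    ... | no  _    | inj₂ w≡z  = ∨⁺ʳ {K₁ w} w≡z

  covers-everything : ∀ z w → (U[ z ] w ∨ (K₀∖ z) w) ≡ true
  covers-everything z w with K₀ w | w ≡ᵇ z
  ... | true  | true  = refl
  ... | true  | false = refl
  ... | false | _     = refl

  module _ (hc : ∀ z → T (K₀ z) → HamiltonianConnectedIn G U[ z ]) where

    private
      K₀∖z⊆K : ∀ z w → T ((K₀∖ z) w) → T (K w)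
      K₀∖z⊆K z w t = ∧⁻ˡ (∧⁻ˡ t)

      K₀∖z∩U : ∀ z w → T ((K₀∖ z) w) → ¬ T (U[ z ] w)
      K₀∖z∩U z w t w∈U with ∨⁻ w∈U
      ... | inj₁ w∉K₀ = not⁻ w∉K₀ (∧⁻ˡ t)
      ... | inj₂ w≡z  = not⁻ (∧⁻ʳ {K₀ w} t) w≡z

      z∈U[z] : ∀ z → T (U[ z ] z)
      z∈U[z] z = ∨⁺ʳ {not (K₀ z)} (≡ᵇ-refl z)

      ∉K₀⇒∈U : ∀ z {w} → ¬ T (K₀ w) → T (U[ z ] w)
      ∉K₀⇒∈U z w∉K₀ = ∨⁺ˡ (not⁺ w∉K₀)

      via : ∀ z {x y} → T (K₀ z) → T (U[ z ] x) → ¬ T (K₀ y) → x ≢ y → SpanningPath G everything x y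
      via z z∈K₀ x∈U y∉K₀ x≢y = spanning-cong (covers-everything z)
        (insert-clique K-clique U[ z ] (K₀∖ z) (K₀∖z⊆K z) (K₀∖z∩U z) (∧⁻ˡ z∈K₀) (z∈U[z] z)
          (λ w zw _ → K₀-neighbours-in-K z∈K₀ zw) (λ z≡y → y∉K₀ (subst (T ∘ K₀) z≡y z∈K₀))
          (hc z z∈K₀ _ _ x∈U (∉K₀⇒∈U z y∉K₀) x≢y))

    hc-by-splicing-K₀ : ∀ {z₀ k} → T (K₀ z₀) → T (K₁ k) → HamiltonianConnectedIn G everything
    hc-by-splicing-K₀ {z₀} {k} z₀∈K₀ k∈K₁ x y _ _ x≢y with T? (K₀ x) | T? (K₀ y)
    ... | yes x∈K₀ | yes y∈K₀ = spanning-cong (covers-everything x)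
      (join-clique K-clique U[ x ] (K₀∖ x) (K₀∖z⊆K x) (K₀∖z∩U x) (∧⁻ˡ k∈K₁) (∉K₀⇒∈U x k∉K₀)
        (∧⁺ y∈K₀ (≢⇒¬≡ᵇ (λ y≡x → x≢y (sym y≡x))))
        (hc x x∈K₀ x k (z∈U[z] x) (∉K₀⇒∈U x k∉K₀) (λ x≡k → k∉K₀ (subst (T ∘ K₀) x≡k x∈K₀))))
      where
      k∉K₀ : ¬ T (K₀ k)
      k∉K₀ k∈K₀ = K₀⇒¬K₁ k∈K₀ k∈K₁
    ... | yes x∈K₀ | no  y∉K₀ = via x x∈K₀ (z∈U[z] x) y∉K₀ x≢y
    ... | no  x∉K₀ | yes y∈K₀ = spanning-reverse G (via y y∈K₀ (z∈U[z] y) x∉K₀ (λ y≡x → x≢y (sym y≡x)))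
    ... | no  x∉K₀ | no  y∉K₀ = via z₀ z₀∈K₀ (∉K₀⇒∈U z₀ x∉K₀) y∉K₀ x≢y

  -- The isomorphisms with the exceptional graphs list K₁ first, then K₀, then R.
  class : Fin n → ℕ
  class v = if K₁ v then 0 else if K v then 1 else 2

  class≤ᵇ0 : ∀ v → (class v ≤ᵇ 0) ≡ K₁ v
  class≤ᵇ0 v = shape (K v) (hasOutsideNeighbour v)
    where
    shape : ∀ k h → ((if k ∧ h then 0 else if k then 1 else 2) ≤ᵇ 0) ≡ k ∧ h
    shape true  true  = refl
    shape true  false = refl
    shape false _     = refl

  class≤ᵇ1 : ∀ v → (class v ≤ᵇ 1) ≡ K v
  class≤ᵇ1 v = shape (K v) (hasOutsideNeighbour v)
    where
    shape : ∀ k h → ((if k ∧ h then 0 else if k then 1 else 2) ≤ᵇ 1) ≡ k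
    shape true  true  = refl
    shape true  false = refl
    shape false _     = refl

  σ : Fin n ↔ Fin n
  σ = proj₁ (sort-by-class class)

  σ-K₁ : ∀ {m} → m ≡ ω₁ → ∀ v → below m (Inverse.to σ v) ≡ K₁ v
  σ-K₁ refl v = trans (cong (toℕ (Inverse.to σ v) <ᵇ_) (sym (count-cong _ _ class≤ᵇ0)))
                      (trans (proj₂ (sort-by-class class) 0 v) (class≤ᵇ0 v))

  σ-K : ∀ v → below ω (Inverse.to σ v) ≡ K v
  σ-K v = trans (cong (toℕ (Inverse.to σ v) <ᵇ_) (sym (trans (count-cong _ _ class≤ᵇ1) |K|≡ω)))
                (trans (proj₂ (sort-by-class class) 1 v) (class≤ᵇ1 v))

  σ-neq : ∀ u v → neq (Inverse.to σ u) (Inverse.to σ v) ≡ neq u v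
  σ-neq = neq-injective (Inverse.to σ) (λ {u} {v} eq →
    trans (sym (Inverse.strictlyInverseʳ σ u)) (trans (cong (Inverse.from σ) eq) (Inverse.strictlyInverseʳ σ v)))

  relabel : ∀ {m} → m ≡ ω₁ → (f : Bool → Bool → Bool → Bool → Bool → Bool) → ∀ u v →
            let σu = Inverse.to σ u ; σv = Inverse.to σ v in
            f (neq σu σv) (below m σu) (below m σv) (below ω σu) (below ω σv) ≡ f (neq u v) (K₁ u) (K₁ v) (K u) (K v)
  relabel m≡ω₁ f u v rewrite σ-neq u v | σ-K₁ m≡ω₁ u | σ-K₁ m≡ω₁ v | σ-K u | σ-K v = refl

  data Class (v : Fin n) : Bool → Bool → Set where
    K₁-class : T (K₁ v) → Class v true  true
    K₀-class : T (K₀ v) → Class v false true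
    R-class  : T (R v)  → Class v false false

  classify : ∀ v → Class v (K₁ v) (K v)
  classify v with K v in k≡ | hasOutsideNeighbour v in h≡
  ... | true  | true  = K₁-class (subst₂ (λ k h → T (k ∧ h)) (sym k≡) (sym h≡) tt)
  ... | true  | false = K₀-class (subst₂ (λ k h → T (k ∧ not h)) (sym k≡) (sym h≡) tt)
  ... | false | _     = R-class (subst (T ∘ not) (sym k≡) tt)

  adj-distinct : ∀ {u v} → (u ≢ v → Adj G u v) → adj G u v ≡ neq u v ∧ true
  adj-distinct {u} {v} adjacent = trans (T-injective (λ uv → neq⁺ (Adj⇒≢ G uv)) (adjacent ∘ neq⁻)) (sym (∧-identityʳ _))

  adj-none : ∀ {u v} → ¬ Adj G u v → adj G u v ≡ neq u v ∧ false
  adj-none {u} {v} ¬uv = trans (T-injective ¬uv ⊥-elim) (sym (∧-zeroʳ _))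

  K₀-R-nonadjacent : ∀ {z s} → T (K₀ z) → T (R s) → ¬ Adj G z s
  K₀-R-nonadjacent z∈K₀ s∈R zs = not⁻ s∈R (K₀-neighbours-in-K z∈K₀ zs)

  -- exceptional₁ n ω and upperH n ω as functions of neq and of the
  -- membership of both ends in the initial segments of length |K₁| and ω.
  shape₁ shape₂ : Bool → Bool → Bool → Bool → Bool → Bool
  shape₁ ne a₁ a₂ b₁ b₂ = ne ∧ ((a₁ ∨ a₂) ∨ ((not a₁ ∧ b₁) ∧ (not a₂ ∧ b₂)))
  shape₂ ne a₁ a₂ b₁ b₂ = ne ∧ ((a₁ ∨ a₂) ∨ (((not a₁ ∧ b₁) ∧ (not a₂ ∧ b₂)) ∨ (not b₁ ∧ not b₂)))

  module _ (R-sees-K₁ : ∀ {s k} → T (R s) → T (K₁ k) → Adj G s k) where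

    K₁-adjacent : ∀ {u v} → T (K₁ u) → u ≢ v → Adj G u v
    K₁-adjacent {u} {v} u∈K₁ u≢v with T? (K v)
    ... | yes v∈K = K-clique u v (∧⁻ˡ u∈K₁) v∈K u≢v
    ... | no  v∉K = Adj-sym G (R-sees-K₁ (not⁺ v∉K) u∈K₁)

    adj-shape₁ : (∀ {s t} → T (R s) → T (R t) → ¬ Adj G s t) →
                 ∀ u v → adj G u v ≡ shape₁ (neq u v) (K₁ u) (K₁ v) (K u) (K v)
    adj-shape₁ R-independent u v = go (classify u) (classify v)
      where
      go : ∀ {a₁ b₁ a₂ b₂} → Class u a₁ b₁ → Class v a₂ b₂ → adj G u v ≡ shape₁ (neq u v) a₁ a₂ b₁ b₂
      go (K₁-class u∈K₁) _               = adj-distinct (K₁-adjacent u∈K₁)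
      go (K₀-class _)    (K₁-class v∈K₁) = adj-distinct (λ u≢v → Adj-sym G (K₁-adjacent v∈K₁ (u≢v ∘ sym)))
      go (R-class _)     (K₁-class v∈K₁) = adj-distinct (λ u≢v → Adj-sym G (K₁-adjacent v∈K₁ (u≢v ∘ sym)))
      go (K₀-class u∈K₀) (K₀-class v∈K₀) = adj-distinct (K-clique u v (∧⁻ˡ u∈K₀) (∧⁻ˡ v∈K₀))
      go (K₀-class u∈K₀) (R-class v∈R)   = adj-none (K₀-R-nonadjacent u∈K₀ v∈R)
      go (R-class u∈R)   (K₀-class v∈K₀) = adj-none (K₀-R-nonadjacent v∈K₀ u∈R ∘ Adj-sym G)
      go (R-class u∈R)   (R-class v∈R)   = adj-none (R-independent u∈R v∈R)

    adj-shape₂ : (∀ {s t} → T (R s) → T (R t) → s ≢ t → Adj G s t) →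
                 ∀ u v → adj G u v ≡ shape₂ (neq u v) (K₁ u) (K₁ v) (K u) (K v)
    adj-shape₂ R-clique u v = go (classify u) (classify v)
      where
      go : ∀ {a₁ b₁ a₂ b₂} → Class u a₁ b₁ → Class v a₂ b₂ → adj G u v ≡ shape₂ (neq u v) a₁ a₂ b₁ b₂
      go (K₁-class u∈K₁) _               = adj-distinct (K₁-adjacent u∈K₁)
      go (K₀-class _)    (K₁-class v∈K₁) = adj-distinct (λ u≢v → Adj-sym G (K₁-adjacent v∈K₁ (u≢v ∘ sym)))
      go (R-class _)     (K₁-class v∈K₁) = adj-distinct (λ u≢v → Adj-sym G (K₁-adjacent v∈K₁ (u≢v ∘ sym)))
      go (K₀-class u∈K₀) (K₀-class v∈K₀) = adj-distinct (K-clique u v (∧⁻ˡ u∈K₀) (∧⁻ˡ v∈K₀))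
      go (K₀-class u∈K₀) (R-class v∈R)   = adj-none (K₀-R-nonadjacent u∈K₀ v∈R)
      go (R-class u∈R)   (K₀-class v∈K₀) = adj-none (K₀-R-nonadjacent v∈K₀ u∈R ∘ Adj-sym G)
      go (R-class u∈R)   (R-class v∈R)   = adj-distinct (R-clique u∈R v∈R)

  sees-K₁ : (∀ {s} → T (R s) → ω₁ ≤ degreeIn G K s) → ∀ {s k} → T (R s) → T (K₁ k) → Adj G s k
  sees-K₁ many s∈R k∈K₁ = ∧⁻ʳ (count-⊆-≥ (λ w → K w ∧ adj G _ w) K₁ (λ w t → K₁-intro s∈R (∧⁻ʳ {K w} t) (∧⁻ˡ t))
                                          (many s∈R) _ k∈K₁)

  exceptional₁-if-R-independent : ω₁ ≡ suc r → (∀ {s t} → T (R s) → T (R t) → ¬ Adj G s t) → G ≅ exceptional₁ n ω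
  exceptional₁-if-R-independent ω₁≡1+r R-independent =
    σ , λ u v → trans (adj-shape₁ (sees-K₁ many) R-independent u v) (sym (relabel n∸ω+1≡ω₁ shape₁ u v))
    where
    n∸ω+1≡ω₁ : n ∸ ω + 1 ≡ ω₁
    n∸ω+1≡ω₁ = trans (cong (λ m → m ∸ ω + 1) n≡ω+r) (trans (cong (_+ 1) (m+n∸m≡n ω r)) (trans (+-comm r 1) (sym ω₁≡1+r)))
    many : ∀ {s} → T (R s) → ω₁ ≤ degreeIn G K s
    many {s} s∈R = subst (_≤ degreeIn G K s) (sym ω₁≡1+r)
      (≤-trans (outside-degree s∈R) (≤-reflexive (trans (cong (degreeIn G K s +_) no-R-neighbours) (+-identityʳ _))))
      where
      no-R-neighbours : degreeIn G R s ≡ 0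
      no-R-neighbours = n≤0⇒n≡0 (≤-trans (count-mono _ (λ _ → false) (λ w t → R-independent s∈R (∧⁻ˡ t) (∧⁻ʳ {R w} t)))
                                          (≤-reflexive (count-false {n})))

  upper-graph : Graph n
  upper-graph = record
    { adj    = upperH n ω
    ; sym    = λ u v → trans (cong (λ ne → shape₂ ne (below 2 u) (below 2 v) (below ω u) (below ω v)) (neq-sym u v))
                             (shape₂-sym (neq v u) (below 2 u) (below 2 v) (below ω u) (below ω v))
    ; irrefl = λ v → cong (λ ne → shape₂ ne (below 2 v) (below 2 v) (below ω v) (below ω v)) (neq-irrefl v)
    }
    where
    neq-sym : ∀ u v → neq u v ≡ neq v u
    neq-sym u v = T-injective (λ t → neq⁺ (λ v≡u → neq⁻ t (sym v≡u))) (λ t → neq⁺ (λ u≡v → neq⁻ t (sym u≡v)))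
    neq-irrefl : ∀ v → neq v v ≡ false
    neq-irrefl v = T-injective (λ t → neq⁻ t refl) ⊥-elim
    shape₂-sym : ∀ ne a₁ a₂ b₁ b₂ → shape₂ ne a₁ a₂ b₁ b₂ ≡ shape₂ ne a₂ a₁ b₂ b₁
    shape₂-sym ne a₁ a₂ b₁ b₂ = cong (ne ∧_) (cong₂ _∨_ (∨-comm a₁ a₂)
      (cong₂ _∨_ (∧-comm (not a₁ ∧ b₁) (not a₂ ∧ b₂)) (∧-comm (not b₁) (not b₂))))

  lowerH⊆upperH : lowerH n ω ⊆ᵍ upperH n ω
  lowerH⊆upperH u v = lower⇒upper (neq u v) (below 2 u) (below 2 v) (below ω u) (below ω v)
                        {below (suc ω) u} {below (suc ω) v} {is ω u} {is ω v}
    where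
    lower⇒upper : ∀ ne a₁ a₂ b₁ b₂ {x y i₁ i₂} →
      T (ne ∧ (((a₁ ∨ a₂) ∧ (x ∧ y)) ∨ (((not a₁ ∧ b₁) ∧ (not a₂ ∧ b₂)) ∨ ((i₁ ∨ i₂) ∧ (not b₁ ∧ not b₂))))) →
      T (shape₂ ne a₁ a₂ b₁ b₂)
    lower⇒upper ne a₁ a₂ b₁ b₂ {x} {y} {i₁} {i₂} t with ∨⁻ {(a₁ ∨ a₂) ∧ (x ∧ y)} (∧⁻ʳ {ne} t)
    ... | inj₁ l = ∧⁺ (∧⁻ˡ {ne} t) (∨⁺ˡ (∧⁻ˡ {a₁ ∨ a₂} l))
    ... | inj₂ m with ∨⁻ {(not a₁ ∧ b₁) ∧ (not a₂ ∧ b₂)} m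
    ...   | inj₁ both-B = ∧⁺ (∧⁻ˡ {ne} t) (∨⁺ʳ {a₁ ∨ a₂} (∨⁺ˡ both-B))
    ...   | inj₂ both-C = ∧⁺ (∧⁻ˡ {ne} t) (∨⁺ʳ {a₁ ∨ a₂} (∨⁺ʳ {(not a₁ ∧ b₁) ∧ (not a₂ ∧ b₂)} (∧⁻ʳ {i₁ ∨ i₂} both-C)))

  inH-if-ω₁≡2 : ω₁ ≡ 2 → InH ω G
  inH-if-ω₁≡2 ω₁≡2 =
    upper-graph , lowerH⊆upperH , (λ _ _ t → t) ,
    σ , λ u v → trans (adj-shape₂ (sees-K₁ many) R-clique u v) (sym (relabel (sym ω₁≡2) shape₂ u v))
    where
    many : ∀ {s} → T (R s) → ω₁ ≤ degreeIn G K s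
    many {s} s∈R = subst (_≤ degreeIn G K s) (sym ω₁≡2) (two-K-neighbours s∈R)
    R-clique : ∀ {s t} → T (R s) → T (R t) → s ≢ t → Adj G s t
    R-clique {s} {t} s∈R t∈R s≢t = ∧⁻ʳ {R t} (count-⊆-≥ (λ w → R w ∧ adj G s w) (R ∖ s)
      (λ w t′ → ∧⁺ (∧⁻ˡ t′) (≢⇒¬≡ᵇ (λ w≡s → Adj⇒≢ G (∧⁻ʳ {R w} t′) (sym w≡s)))) enough t
      (∧⁺ t∈R (≢⇒¬≡ᵇ (λ t≡s → s≢t (sym t≡s)))))
      where
      enough : count (R ∖ s) ≤ degreeIn G R s
      enough = +-cancelˡ-≤ 2 _ _ (begin
        2 + count (R ∖ s)                  ≡⟨ cong suc (sym (count-remove R s s∈R)) ⟩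
        suc r                              ≤⟨ outside-degree s∈R ⟩
        degreeIn G K s + degreeIn G R s    ≤⟨ +-monoˡ-≤ _ (subst (degreeIn G K s ≤_) ω₁≡2 (K-neighbours-in-K₁ s∈R)) ⟩
        2 + degreeIn G R s                 ∎)
        where open ≤-Reasoning

  everything-admissible : Admissible everything
  everything-admissible = record { R⊆U = λ _ → tt ; R-neighbours⊆U = λ _ _ → tt }

  hamiltonian : HamiltonianConnectedIn G everything → HamiltonianConnected G
  hamiltonian hc u v u≢v = spanning⇒hamiltonian G u≢v (hc u v tt tt u≢v)

  Exceptional : Set
  Exceptional = (n + 2 ≤ 2 * ω × ω ≤ n ∸ 1) × (G ≅ exceptional₁ n ω ⊎ InH ω G)

  module _ (2δ≤n : δ + δ ≤ n) {s₀} (s₀∈R : T (R s₀)) where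

    n+2≤2ω : n + 2 ≤ ω + ω
    n+2≤2ω = +-cancelˡ-≤ n _ _ (begin
      n + (n + 2)              ≡⟨ solve 1 (λ n → n :+ (n :+ con 2) := (n :+ con 1) :+ (n :+ con 1)) refl n ⟩
      (n + 1) + (n + 1)        ≤⟨ +-mono-≤ n<δ+ω n<δ+ω ⟩
      (δ + ω) + (δ + ω)        ≡⟨ +-interchange δ ω δ ω ⟩
      (δ + δ) + (ω + ω)        ≤⟨ +-monoˡ-≤ (ω + ω) 2δ≤n ⟩
      n + (ω + ω)              ∎)
      where
      open ≤-Reasoning
      open +-*-Solver using (solve; _:+_; _:=_; con)

    bounds : n + 2 ≤ 2 * ω × ω ≤ n ∸ 1
    bounds = subst (n + 2 ≤_) (cong (ω +_) (sym (+-identityʳ ω))) n+2≤2ω ,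
             m+n≤o⇒m≤o∸n ω (subst (ω + 1 ≤_) (sym n≡ω+r) (+-monoʳ-≤ ω (count-witness R s₀ s₀∈R)))

    K₁-vertex : ∃ λ k → T (K₁ k)
    K₁-vertex = count-nonempty K₁ (≤-trans (s≤s z≤n) (ω₁≥2 s₀∈R))

    hc-without-K₀ : (∀ z → ¬ T (K₀ z)) → HamiltonianConnectedIn G everything
    hc-without-K₀ K₀-empty = hc-by-K₁-degrees everything everything-admissible (begin-strict
      count everything   ≡⟨ count-true ⟩
      n                  <⟨ ≤-trans (n≤1+n (suc n)) (≤-trans (≤-reflexive (+-comm 2 n)) n+2≤2ω) ⟩
      ω + ω              ≤⟨ +-mono-≤ ω≤ω₁ ω≤ω₁ ⟩
      ω₁ + ω₁            ∎)
      where
      open ≤-Reasoning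
      ω≤ω₁ : ω ≤ ω₁
      ω≤ω₁ = subst (_≤ ω₁) |K|≡ω (count-mono K K₁ K⊆K₁)
        where
        K⊆K₁ : ∀ v → T (K v) → T (K₁ v)
        K⊆K₁ v v∈K with T? (K₁ v)
        ... | yes v∈K₁ = v∈K₁
        ... | no  v∉K₁ = ⊥-elim (K₀-empty v (K∖K₁⇒K₀ v∈K v∉K₁))

    module _ {z₀} (z₀∈K₀ : T (K₀ z₀)) where

      from-U : (∀ z → T (K₀ z) → HamiltonianConnectedIn G U[ z ]) → HamiltonianConnected G ⊎ Exceptional
      from-U hc = inj₁ (hamiltonian (hc-by-splicing-K₀ hc z₀∈K₀ (proj₂ K₁-vertex)))

      conclusion-with-K₀ : HamiltonianConnected G ⊎ Exceptional
      conclusion-with-K₀ with r + 2 ≤? ω₁ | ω₁ ≟ⁿ suc r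
      ... | yes r+2≤ω₁ | _ = from-U (λ z _ → hc-by-K₁-degrees U[ z ] (U-admissible z) (begin-strict
        count U[ z ]     ≤⟨ |U[ z ]| ⟩
        suc (ω₁ + r)     <⟨ ≤-reflexive (trans (+-comm 2 (ω₁ + r)) (+-assoc ω₁ r 2)) ⟩
        ω₁ + (r + 2)     ≤⟨ +-monoʳ-≤ ω₁ r+2≤ω₁ ⟩
        ω₁ + ω₁          ∎))
        where open ≤-Reasoning
      ... | no _ | yes ω₁≡1+r with any? (λ t → any? (λ t′ → T? (R t ∧ (R t′ ∧ adj G t t′))))
      ...   | yes (t₀ , t₁ , e) = from-U (λ z _ → hc-with-outside-edge (U-admissible z) |U[ z ]| ω₁≡1+r
                                           (∧⁻ˡ e) (∧⁻ˡ (∧⁻ʳ {R t₀} e)) (∧⁻ʳ {R t₁} (∧⁻ʳ {R t₀} e)))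
      ...   | no none = inj₂ (bounds , inj₁ (exceptional₁-if-R-independent ω₁≡1+r (λ {s} {t} s∈R t∈R st → none (s , t , ∧⁺ s∈R (∧⁺ t∈R st)))))
      conclusion-with-K₀ | no ω₁<r+2 | no ω₁≢1+r with 3 ≤? ω₁
      ... | yes 3≤ω₁ = from-U (λ z _ → hc-if-3≤ω₁≤r (U-admissible z) z (U-outside-K₁ z) |U[ z ]| 3≤ω₁ ω₁≤r)
        where
        ω₁≤r : ω₁ ≤ r
        ω₁≤r = ≤-pred (≤∧≢⇒< (≤-pred (subst (suc ω₁ ≤_) (+-comm r 2) (≰⇒> ω₁<r+2))) ω₁≢1+r)
      ... | no ω₁<3 = inj₂ (bounds , inj₂ (inH-if-ω₁≡2 (≤-antisym (≤-pred (≰⇒> ω₁<3)) (ω₁≥2 s₀∈R))))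

    conclusion-with-R : HamiltonianConnected G ⊎ Exceptional
    conclusion-with-R with any? (λ z → T? (K₀ z))
    ... | no  K₀-empty      = inj₁ (hamiltonian (hc-without-K₀ (λ z z∈K₀ → K₀-empty (z , z∈K₀))))
    ... | yes (z₀ , z₀∈K₀) = conclusion-with-K₀ z₀∈K₀

  conclusion : HamiltonianConnected G ⊎ Exceptional
  conclusion with suc n ≤? δ + δ | any? (λ s → T? (R s))
  ... | yes n<2δ | _               = inj₁ (hamiltonian (hc-if-n<2δ n<2δ))
  ... | no  _    | no  R-empty     = inj₁ (hamiltonian (hc-if-R-empty (λ v v∈R → R-empty (v , v∈R))))
  ... | no  n≮2δ | yes (s₀ , s₀∈R) = conclusion-with-R (≤-pred (≰⇒> n≮2δ)) s₀∈R

corollary1p7 : (n : ℕ) (G : Graph n) (δ ω : ℕ) →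
    IsMinDegree G δ → IsCliqueNumber G ω → n + 1 ≤ δ + ω →
    HamiltonianConnected G ⊎
      ((n + 2 ≤ 2 * ω × ω ≤ n ∸ 1) × (G ≅ exceptional₁ n ω ⊎ InH ω G))
corollary1p7 n G δ ω (δ≤degree , _) ((S , S-clique , |S|≡ω) , _) n<δ+ω =
  Argument.conclusion G δ ω (lookup S) K-clique (trans (sym (∣∣≡count S)) |S|≡ω)
    (λ v → subst (δ ≤_) (degree≡count G v) (δ≤degree v)) n<δ+ω
  where
  ∈S : ∀ {v} → T (lookup S v) → v ∈ S
  ∈S {v} t = lookup⇒[]= v S (Equivalence.to T-≡ t)
  K-clique : IsCliqueᵇ G (lookup S)
  K-clique u v u∈S v∈S = S-clique u v (∈S u∈S) (∈S v∈S)
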